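{- Let $T$ be a conceptual theory. Suppose $A(x)$, $B(y)$, $E_A(x,x')$, $E_B(y,y')$, $F(x,y)$, $G(y,x)$ are formulas in the language of $T$ such that $T$ proves that $E_A$ is an equivalence relation on $\{x\mid A(x)\}$, that $E_B$ is an equivalence relation on $\{y\mid B(y)\}$, that $F$ is an injection from $\{x\mid A(x)\}/E_A$ to $\{y\mid B(y)\}/E_B$, and that $G$ is an injection from $\{y\mid B(y)\}/E_B$ to $\{x\mid A(x)\}/E_A$. Then there is a formula $H(x,y)$ in the language of $T$ such that $T$ proves that $H$ is a bijection between $\{x\mid A(x)\}/E_A$ and $\{y\mid B(y)\}/E_B$.
   Context: Theories are first-order theories with identity. "$F$ is an injection from $\{x\mid A x\}/E_A$ to $\{y\mid By\}/E_B$" means: $F(x,y)$ implies $A(x)$ and $B(y)$; if $x\,E_A\,x'$, $F(x',y')$, $y'\,E_B\,y$ then $F(x,y)$; every $x$ with $A(x)$ has some $y$ with $F(x,y)$; $F(x,y)\wedge F(x,y')$ implies $y\,E_B\,y'$; $F(x,y)\wedge F(x',y)$ implies $x\,E_A\,x'$. A bijection additionally satisfies: every $y$ with $B(y)$ has some $x$ with $H(x,y)$. The theory $\mathsf{ac}$ is two-sorted, with a sort $\mathfrak o$ of objects and a sort $\mathfrak c$ of classes, identity on each sort and membership $\in$ of type $\mathfrak o\mathfrak c$, with axioms: there is a class with no members; for every class $Y$ and object $y$ there is a class $X$ with $\forall x\,(x\in X\leftrightarrow(x\in Y\vee x=y))$; two classes with the same members are equal. An interpretation of $\mathsf{ac}$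 in a one-sorted theory $T$ assigns to each sort $\mathfrak a$ a dimension $m_{\mathfrak a}$ and a domain formula $\delta_{\mathfrak a}(\vec x)$ with $\vec x$ of length $m_{\mathfrak a}$, and to each predicate (including identity on each sort) a $T$-formula on tuples of the appropriate lengths; formulas are translated by commuting with connectives and relativizing each quantifier over sort $\mathfrak a$ to $\delta_{\mathfrak a}$; it is required that $T$ proves the translation of every theorem of $\mathsf{ac}$. The interpretation is $\mathfrak o$-direct if $m_{\mathfrak o}=1$, $\delta_{\mathfrak o}(x)$ is $x=x$, and identity on sort $\mathfrak o$ is translated as identity. A theory $T$ is conceptual iff there is an $\mathfrak o$-direct interpretation of $\mathsf{ac}$ in $T$. -}

module Defs where

open import Data.Nat using (ℕ; zero; suc)
open import Data.List using (List; []; _∷_; _++_; replicate; length; map)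
open import Data.List.Membership.Propositional using (_∈_)
open import Data.Unit using (⊤; tt)
open import Data.Empty using (⊥)
open import Data.Product using (Σ; _×_; _,_)
open import Relation.Binary.PropositionalEquality using (_≡_; subst; sym)

-- Many-sorted first-order languages with identity (de Bruijn syntax)

record Signature : Set₁ where
  field
    Sort : Set
    Fun  : List Sort → Sort → Set
    Rel  : List Sort → Set

module Syntax (L : Signature) where
  open Signature L

  infix 4 _∋_
  data _∋_ : List Sort → Sort → Set where
    here  : ∀ {Γ s} → (s ∷ Γ) ∋ s
    there : ∀ {Γ s t} → Γ ∋ s → (t ∷ Γ) ∋ s

  data Term (Γ : List Sort) : Sort → Set
  data Terms (Γ : List Sort) : List Sort → Set

  data Term Γ where
    var : ∀ {s} → Γ ∋ s → Term Γ s
    fun : ∀ {ss s} → Fun ss s → Terms Γ ss → Term Γ s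

  data Terms Γ where
    []  : Terms Γ []
    _∷_ : ∀ {s ss} → Term Γ s → Terms Γ ss → Terms Γ (s ∷ ss)

  infixr 6 _∧'_
  infixr 5 _∨'_
  infixr 4 _⇒_
  infix 7 _≐_
  data Formula (Γ : List Sort) : Set where
    ⊥'   : Formula Γ
    rel  : ∀ {ss} → Rel ss → Terms Γ ss → Formula Γ
    _≐_  : ∀ {s} → Term Γ s → Term Γ s → Formula Γ
    _⇒_  : Formula Γ → Formula Γ → Formula Γ
    _∧'_ : Formula Γ → Formula Γ → Formula Γ
    _∨'_ : Formula Γ → Formula Γ → Formula Γ
    ∀'   : (s : Sort) → Formula (s ∷ Γ) → Formula Γ
    ∃'   : (s : Sort) → Formula (s ∷ Γ) → Formula Γ

  ¬' : ∀ {Γ} → Formula Γ → Formula Γ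
  ¬' φ = φ ⇒ ⊥'

  infix 3 _⇔'_
  _⇔'_ : ∀ {Γ} → Formula Γ → Formula Γ → Formula Γ
  φ ⇔' ψ = (φ ⇒ ψ) ∧' (ψ ⇒ φ)

  Ren : List Sort → List Sort → Set
  Ren Γ Δ = ∀ {s} → Γ ∋ s → Δ ∋ s

  liftR : ∀ {Γ Δ t} → Ren Γ Δ → Ren (t ∷ Γ) (t ∷ Δ)
  liftR ρ here      = here
  liftR ρ (there v) = there (ρ v)

  renT  : ∀ {Γ Δ s}  → Ren Γ Δ → Term Γ s → Term Δ s
  renTs : ∀ {Γ Δ ss} → Ren Γ Δ → Terms Γ ss → Terms Δ ss
  renT ρ (var v)    = var (ρ v)
  renT ρ (fun f ts) = fun f (renTs ρ ts)
  renTs ρ []       = []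
  renTs ρ (t ∷ ts) = renT ρ t ∷ renTs ρ ts

  ren : ∀ {Γ Δ} → Ren Γ Δ → Formula Γ → Formula Δ
  ren ρ ⊥'         = ⊥'
  ren ρ (rel r ts) = rel r (renTs ρ ts)
  ren ρ (t ≐ u)    = renT ρ t ≐ renT ρ u
  ren ρ (φ ⇒ ψ)    = ren ρ φ ⇒ ren ρ ψ
  ren ρ (φ ∧' ψ)   = ren ρ φ ∧' ren ρ ψ
  ren ρ (φ ∨' ψ)   = ren ρ φ ∨' ren ρ ψ
  ren ρ (∀' s φ)   = ∀' s (ren (liftR ρ) φ)
  ren ρ (∃' s φ)   = ∃' s (ren (liftR ρ) φ)

  wk : ∀ {Γ t} → Formula Γ → Formula (t ∷ Γ)
  wk = ren there

  fromEmpty : ∀ {Γ} → Ren [] Γ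
  fromEmpty ()

  Sub : List Sort → List Sort → Set
  Sub Γ Δ = ∀ {s} → Γ ∋ s → Term Δ s

  liftS : ∀ {Γ Δ t} → Sub Γ Δ → Sub (t ∷ Γ) (t ∷ Δ)
  liftS σ here      = var here
  liftS σ (there v) = renT there (σ v)

  subT  : ∀ {Γ Δ s}  → Sub Γ Δ → Term Γ s → Term Δ s
  subTs : ∀ {Γ Δ ss} → Sub Γ Δ → Terms Γ ss → Terms Δ ss
  subT σ (var v)    = σ v
  subT σ (fun f ts) = fun f (subTs σ ts)
  subTs σ []       = []
  subTs σ (t ∷ ts) = subT σ t ∷ subTs σ ts

  sub : ∀ {Γ Δ} → Sub Γ Δ → Formula Γ → Formula Δ
  sub σ ⊥'         = ⊥'
  sub σ (rel r ts) = rel r (subTs σ ts)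
  sub σ (t ≐ u)    = subT σ t ≐ subT σ u
  sub σ (φ ⇒ ψ)    = sub σ φ ⇒ sub σ ψ
  sub σ (φ ∧' ψ)   = sub σ φ ∧' sub σ ψ
  sub σ (φ ∨' ψ)   = sub σ φ ∨' sub σ ψ
  sub σ (∀' s φ)   = ∀' s (sub (liftS σ) φ)
  sub σ (∃' s φ)   = ∃' s (sub (liftS σ) φ)

  sub1 : ∀ {Γ s} → Term Γ s → Sub (s ∷ Γ) Γ
  sub1 t here      = t
  sub1 t (there v) = var v

  _[_] : ∀ {Γ s} → Formula (s ∷ Γ) → Term Γ s → Formula Γ
  φ [ t ] = sub (sub1 t) φ

  Theory : Set₁
  Theory = Formula [] → Set

  -- Classical natural deduction with identity; the rule 'inhab'
  -- expresses the standard assumption that every sort is nonempty.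
  data Deriv (T : Theory) : (Γ : List Sort) → List (Formula Γ) → Formula Γ → Set where
    hyp   : ∀ {Γ H φ} → φ ∈ H → Deriv T Γ H φ
    ax    : ∀ {Γ H φ} → T φ → Deriv T Γ H (ren fromEmpty φ)
    raa   : ∀ {Γ H φ} → Deriv T Γ (¬' φ ∷ H) ⊥' → Deriv T Γ H φ
    ⇒I    : ∀ {Γ H φ ψ} → Deriv T Γ (φ ∷ H) ψ → Deriv T Γ H (φ ⇒ ψ)
    ⇒E    : ∀ {Γ H φ ψ} → Deriv T Γ H (φ ⇒ ψ) → Deriv T Γ H φ → Deriv T Γ H ψ
    ∧I    : ∀ {Γ H φ ψ} → Deriv T Γ H φ → Deriv T Γ H ψ → Deriv T Γ H (φ ∧' ψ)
    ∧E₁   : ∀ {Γ H φ ψ} → Deriv T Γ H (φ ∧' ψ) → Deriv T Γ H φ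
    ∧E₂   : ∀ {Γ H φ ψ} → Deriv T Γ H (φ ∧' ψ) → Deriv T Γ H ψ
    ∨I₁   : ∀ {Γ H φ ψ} → Deriv T Γ H φ → Deriv T Γ H (φ ∨' ψ)
    ∨I₂   : ∀ {Γ H φ ψ} → Deriv T Γ H ψ → Deriv T Γ H (φ ∨' ψ)
    ∨E    : ∀ {Γ H φ ψ χ} → Deriv T Γ H (φ ∨' ψ) → Deriv T Γ (φ ∷ H) χ
          → Deriv T Γ (ψ ∷ H) χ → Deriv T Γ H χ
    ∀I    : ∀ {Γ H s φ} → Deriv T (s ∷ Γ) (map wk H) φ → Deriv T Γ H (∀' s φ)
    ∀E    : ∀ {Γ H s φ} → Deriv T Γ H (∀' s φ) → (t : Term Γ s) → Deriv T Γ H (φ [ t ])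
    ∃I    : ∀ {Γ H s φ} → (t : Term Γ s) → Deriv T Γ H (φ [ t ]) → Deriv T Γ H (∃' s φ)
    ∃E    : ∀ {Γ H s φ χ} → Deriv T Γ H (∃' s φ) → Deriv T (s ∷ Γ) (φ ∷ map wk H) (wk χ)
          → Deriv T Γ H χ
    ≐refl : ∀ {Γ H s} → (t : Term Γ s) → Deriv T Γ H (t ≐ t)
    ≐E    : ∀ {Γ H s t u} → (φ : Formula (s ∷ Γ)) → Deriv T Γ H (t ≐ u)
          → Deriv T Γ H (φ [ t ]) → Deriv T Γ H (φ [ u ])
    inhab : ∀ {Γ H φ} → (s : Sort) → Deriv T (s ∷ Γ) (map wk H) (wk φ) → Deriv T Γ H φ

  Proves : Theory → Formula [] → Set
  Proves T φ = Deriv T [] [] φ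

record OneSorted : Set₁ where
  field
    FunSym : ℕ → Set
    RelSym : ℕ → Set

toSig : OneSorted → Signature
toSig L = record
  { Sort = ⊤
  ; Fun  = λ ss _ → OneSorted.FunSym L (length ss)
  ; Rel  = λ ss → OneSorted.RelSym L (length ss)
  }

ctx : ℕ → List ⊤
ctx n = replicate n tt

data SortAC : Set where
  o c : SortAC

data FunAC : List SortAC → SortAC → Set where

data RelAC : List SortAC → Set where
  mem : RelAC (o ∷ c ∷ [])

ACSig : Signature
ACSig = record { Sort = SortAC ; Fun = FunAC ; Rel = RelAC }

module AC = Syntax ACSig

private
  module A = Syntax ACSig
  _∈'_ : ∀ {Γ} → Γ A.∋ o → Γ A.∋ c → A.Formula Γ
  x ∈' X = A.rel mem (A.var x A.∷ (A.var X A.∷ A.[]))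

data acAxioms : A.Formula [] → Set where
  emptyClass : acAxioms (A.∃' c (A.∀' o (A.¬' (A.here ∈' A.there A.here))))
  adjunction : acAxioms
    (A.∀' c (A.∀' o (A.∃' c (A.∀' o
      ((A.here ∈' A.there A.here) A.⇔'
        ((A.here ∈' A.there (A.there (A.there A.here)))
          A.∨' (A.var A.here A.≐ A.var (A.there (A.there A.here)))))))))
  extensionality : acAxioms
    (A.∀' c (A.∀' c
      ((A.∀' o ((A.here ∈' A.there (A.there A.here)) A.⇔' (A.here ∈' A.there A.here)))
        A.⇒ (A.var (A.there A.here) A.≐ A.var A.here))))

module _ (L : OneSorted) where
  private
    module S = Syntax (toSig L)

  record Interpretation : Set where
    field
      dim : SortAC → ℕ
      dom : (s : SortAC) → S.Formula (ctx (dim s))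
      memT : S.Formula (ctx (dim o) ++ ctx (dim c))
      eqT  : (s : SortAC) → S.Formula (ctx (dim s) ++ ctx (dim s))

  module Translate (I : Interpretation) where
    open Interpretation I

    injL : ∀ {xs ys} → S.Ren xs (xs ++ ys)
    injL S.here      = S.here
    injL (S.there v) = S.there (injL v)

    injR : ∀ xs {ys} → S.Ren ys (xs ++ ys)
    injR []       v = v
    injR (_ ∷ xs) v = S.there (injR xs v)

    pairR : ∀ {xs ys Δ} → S.Ren xs Δ → S.Ren ys Δ → S.Ren (xs ++ ys) Δ
    pairR {[]}     ρ₁ ρ₂ v           = ρ₂ v
    pairR {_ ∷ xs} ρ₁ ρ₂ S.here      = ρ₁ S.here
    pairR {_ ∷ xs} ρ₁ ρ₂ (S.there v) = pairR (λ w → ρ₁ (S.there w)) ρ₂ v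

    ctx* : List SortAC → List ⊤
    ctx* []      = []
    ctx* (s ∷ Γ) = ctx (dim s) ++ ctx* Γ

    -- the block of variables translating an ac variable
    varT : ∀ {Γ s} → Γ A.∋ s → S.Ren (ctx (dim s)) (ctx* Γ)
    varT {s ∷ Γ} A.here      w = injL w
    varT {t ∷ Γ} (A.there v) w = injR (ctx (dim t)) (varT v w)

    trTerm : ∀ {Γ s} → A.Term Γ s → S.Ren (ctx (dim s)) (ctx* Γ)
    trTerm (A.var v)   = varT v
    trTerm (A.fun () _)

    ∀ⁿ : ∀ {Δ} n → S.Formula (ctx n ++ Δ) → S.Formula Δ
    ∀ⁿ zero    φ = φ
    ∀ⁿ (suc n) φ = ∀ⁿ n (S.∀' tt φ)

    ∃ⁿ : ∀ {Δ} n → S.Formula (ctx n ++ Δ) → S.Formula Δ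
    ∃ⁿ zero    φ = φ
    ∃ⁿ (suc n) φ = ∃ⁿ n (S.∃' tt φ)

    tr : ∀ {Γ} → A.Formula Γ → S.Formula (ctx* Γ)
    tr A.⊥' = S.⊥'
    tr (A.rel mem (t A.∷ (u A.∷ A.[]))) = S.ren (pairR (trTerm t) (trTerm u)) memT
    tr (A._≐_ {s} t u) = S.ren (pairR (trTerm t) (trTerm u)) (eqT s)
    tr (φ A.⇒ ψ)  = tr φ S.⇒ tr ψ
    tr (φ A.∧' ψ) = tr φ S.∧' tr ψ
    tr (φ A.∨' ψ) = tr φ S.∨' tr ψ
    tr (A.∀' s φ) = ∀ⁿ (dim s) (S.ren injL (dom s) S.⇒ tr φ)
    tr (A.∃' s φ) = ∃ⁿ (dim s) (S.ren injL (dom s) S.∧' tr φ)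

  IsInterpretationIn : S.Theory → Interpretation → Set
  IsInterpretationIn T I =
    (φ : A.Formula []) → A.Proves acAxioms φ → S.Proves T (Translate.tr I φ)

  -- o-direct: dimension 1, trivial domain, identity translated as identity
  oDirect : Interpretation → Set
  oDirect I =
    Σ (Interpretation.dim I o ≡ 1) λ p →
      (Interpretation.dom I o ≡
         subst (λ n → S.Formula (ctx n)) (sym p) (S.var S.here S.≐ S.var S.here))
      × (Interpretation.eqT I o ≡
         subst (λ n → S.Formula (ctx n ++ ctx n)) (sym p)
           (S.var S.here S.≐ S.var (S.there S.here)))

  Conceptual : S.Theory → Set
  Conceptual T = Σ Interpretation λ I → oDirect I × IsInterpretationIn T I

  private
    v0 : ∀ {Γ} → (tt ∷ Γ) S.∋ tt
    v0 = S.here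
    v1 : ∀ {Γ a} → (a ∷ tt ∷ Γ) S.∋ tt
    v1 = S.there S.here
    v2 : ∀ {Γ a b} → (a ∷ b ∷ tt ∷ Γ) S.∋ tt
    v2 = S.there (S.there S.here)
    v3 : ∀ {Γ a b d} → (a ∷ b ∷ d ∷ tt ∷ Γ) S.∋ tt
    v3 = S.there (S.there (S.there S.here))
    ∀₁ : ∀ {Γ} → S.Formula (tt ∷ Γ) → S.Formula Γ
    ∀₁ = S.∀' tt
    ∃₁ : ∀ {Γ} → S.Formula (tt ∷ Γ) → S.Formula Γ
    ∃₁ = S.∃' tt

  at1 : ∀ {Γ} → S.Formula (ctx 1) → Γ S.∋ tt → S.Formula Γ
  at1 {Γ} φ x = S.ren ρ φ
    where
      ρ : S.Ren (ctx 1) Γ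
      ρ S.here = x
      ρ (S.there ())

  at2 : ∀ {Γ} → S.Formula (ctx 2) → Γ S.∋ tt → Γ S.∋ tt → S.Formula Γ
  at2 {Γ} φ x y = S.ren ρ φ
    where
      ρ : S.Ren (ctx 2) Γ
      ρ S.here = x
      ρ (S.there S.here) = y
      ρ (S.there (S.there ()))

  EquivRelOn : S.Theory → S.Formula (ctx 1) → S.Formula (ctx 2) → Set
  EquivRelOn T A E =
      S.Proves T (∀₁ (∀₁ (at2 E v1 v0 S.⇒ at1 A v1 S.∧' at1 A v0)))
    × S.Proves T (∀₁ (at1 A v0 S.⇒ at2 E v0 v0))
    × S.Proves T (∀₁ (∀₁ (at2 E v1 v0 S.⇒ at2 E v0 v1)))
    × S.Proves T (∀₁ (∀₁ (∀₁ (at2 E v2 v1 S.∧' at2 E v1 v0 S.⇒ at2 E v2 v0))))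

  Injection : S.Theory → S.Formula (ctx 1) → S.Formula (ctx 2)
            → S.Formula (ctx 1) → S.Formula (ctx 2) → S.Formula (ctx 2) → Set
  Injection T A EA B EB F =
      -- F(x,y) → A(x) ∧ B(y)          (x = v1, y = v0)
      S.Proves T (∀₁ (∀₁ (at2 F v1 v0 S.⇒ at1 A v1 S.∧' at1 B v0)))
      -- x EA x', F(x',y'), y' EB y → F(x,y)   (x = v3, x' = v2, y' = v1, y = v0)
    × S.Proves T (∀₁ (∀₁ (∀₁ (∀₁
        (at2 EA v3 v2 S.∧' at2 F v2 v1 S.∧' at2 EB v1 v0 S.⇒ at2 F v3 v0)))))
    × S.Proves T (∀₁ (at1 A v0 S.⇒ ∃₁ (at2 F v1 v0)))
      -- F(x,y) ∧ F(x,y') → y EB y'   (x = v2, y = v1, y' = v0)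
    × S.Proves T (∀₁ (∀₁ (∀₁ (at2 F v2 v1 S.∧' at2 F v2 v0 S.⇒ at2 EB v1 v0))))
      -- F(x,y) ∧ F(x',y) → x EA x'   (x = v2, x' = v1, y = v0)
    × S.Proves T (∀₁ (∀₁ (∀₁ (at2 F v2 v0 S.∧' at2 F v1 v0 S.⇒ at2 EA v2 v1))))

  Bijection : S.Theory → S.Formula (ctx 1) → S.Formula (ctx 2)
            → S.Formula (ctx 1) → S.Formula (ctx 2) → S.Formula (ctx 2) → Set
  Bijection T A EA B EB H =
      Injection T A EA B EB H
      -- B(y) → ∃x H(x,y)    (y = v1 inside, x = v0)
    × S.Proves T (∀₁ (at1 B v0 S.⇒ ∃₁ (at2 H v0 v1)))

{-# OPTIONS --safe #-}
module Submission where

-- The classical Schröder–Bernstein argument, carried out inside T with the classes of ac in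
-- place of sets. Call x in A traced if it is EA-equivalent to a member of a class XA such that,
-- for some class XB, every member of XA has a G-preimage in XB and every member of XB that is an
-- F-image has an F-preimage in XA. Let H x y hold iff either x is traced and G y x, or x is not
-- traced and F x y. Traced elements are closed under one backward step x ↦ F⁻¹(G⁻¹ x) and one
-- forward step z ↦ G(F z); G(y) is traced when y is not an F-image. These closure properties
-- alone make H a bijection, so no induction along chains is needed. Empty class and adjunction
-- build the witnessing pairs one element at a time. Because the interpretation is o-direct,
-- "x is traced" translates to a T-formula in the single variable x.

open import Defs
open import Data.Product using (Σ; _×_; _,_; proj₁; proj₂)
open import Data.Nat using (ℕ; zero; suc)
open import Data.Unit using (tt)
import Data.List.Relation.Unary.Any as Any

open import Data.List using (List; []; _∷_; _++_; map)
open import Data.List.Properties using (map-∘; map-cong; map-id)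
open import Data.List.Membership.Propositional using (_∈_)
open import Data.List.Membership.Propositional.Properties using (∈-map⁺)
open import Data.List.Relation.Binary.Subset.Propositional using (_⊆_)
open import Data.List.Relation.Binary.Subset.Propositional.Properties using (map⁺; ∷⁺ʳ; xs⊆x∷xs)
open import Relation.Binary.PropositionalEquality
  using (_≡_; refl; sym; trans; cong; cong₂; subst; subst₂; module ≡-Reasoning)

map-square : ∀ {A B C D : Set} {f : A → B} {g : B → D} {h : A → C} {k : C → D} →
             (∀ x → g (f x) ≡ k (h x)) → ∀ xs → map g (map f xs) ≡ map k (map h xs)
map-square eq xs = trans (sym (map-∘ xs)) (trans (map-cong eq xs) (map-∘ xs))

module SyntaxProperties (Sg : Signature) where
  open Syntax Sg

  infix 4 _≗ʳ_ _≗ˢ_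

  _≗ʳ_ : ∀ {Γ Δ} → Ren Γ Δ → Ren Γ Δ → Set
  ρ ≗ʳ ρ′ = ∀ {s} v → ρ {s} v ≡ ρ′ v

  _≗ˢ_ : ∀ {Γ Δ} → Sub Γ Δ → Sub Γ Δ → Set
  σ ≗ˢ σ′ = ∀ {s} v → σ {s} v ≡ σ′ v

  liftR-cong : ∀ {Γ Δ t} {ρ ρ′ : Ren Γ Δ} → ρ ≗ʳ ρ′ → liftR {t = t} ρ ≗ʳ liftR ρ′
  liftR-cong eq here      = refl
  liftR-cong eq (there v) = cong there (eq v)

  liftR-id : ∀ {Γ t} → liftR {Γ} {Γ} {t} (λ v → v) ≗ʳ (λ v → v)
  liftR-id here      = refl
  liftR-id (there v) = refl

  liftR-∘ : ∀ {Γ Δ Θ t} (σ : Ren Δ Θ) (ρ : Ren Γ Δ) →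
            (λ {s} (v : (t ∷ Γ) ∋ s) → liftR σ (liftR ρ v)) ≗ʳ liftR (λ v → σ (ρ v))
  liftR-∘ σ ρ here      = refl
  liftR-∘ σ ρ (there v) = refl

  liftS-cong : ∀ {Γ Δ t} {σ σ′ : Sub Γ Δ} → σ ≗ˢ σ′ → liftS {t = t} σ ≗ˢ liftS σ′
  liftS-cong eq here      = refl
  liftS-cong eq (there v) = cong (renT there) (eq v)

  liftS-liftR : ∀ {Γ Δ Θ t} (σ : Sub Δ Θ) (ρ : Ren Γ Δ) →
                (λ {s} (v : (t ∷ Γ) ∋ s) → liftS σ (liftR ρ v)) ≗ˢ liftS (λ v → σ (ρ v))
  liftS-liftR σ ρ here      = refl
  liftS-liftR σ ρ (there v) = refl

  liftS-var : ∀ {Γ Δ t} (ρ : Ren Γ Δ) →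
              liftS {t = t} (λ v → var (ρ v)) ≗ˢ (λ v → var (liftR ρ v))
  liftS-var ρ here      = refl
  liftS-var ρ (there v) = refl

  renT-cong  : ∀ {Γ Δ s}  {ρ ρ′ : Ren Γ Δ} → ρ ≗ʳ ρ′ → (t : Term Γ s) → renT ρ t ≡ renT ρ′ t
  renTs-cong : ∀ {Γ Δ ss} {ρ ρ′ : Ren Γ Δ} → ρ ≗ʳ ρ′ → (ts : Terms Γ ss) → renTs ρ ts ≡ renTs ρ′ ts
  renT-cong eq (var v)    = cong var (eq v)
  renT-cong eq (fun f ts) = cong (fun f) (renTs-cong eq ts)
  renTs-cong eq []       = refl
  renTs-cong eq (t ∷ ts) = cong₂ _∷_ (renT-cong eq t) (renTs-cong eq ts)

  ren-cong : ∀ {Γ Δ} {ρ ρ′ : Ren Γ Δ} → ρ ≗ʳ ρ′ → (φ : Formula Γ) → ren ρ φ ≡ ren ρ′ φ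
  ren-cong eq ⊥'         = refl
  ren-cong eq (rel r ts) = cong (rel r) (renTs-cong eq ts)
  ren-cong eq (t ≐ u)    = cong₂ _≐_ (renT-cong eq t) (renT-cong eq u)
  ren-cong eq (φ ⇒ ψ)    = cong₂ _⇒_ (ren-cong eq φ) (ren-cong eq ψ)
  ren-cong eq (φ ∧' ψ)   = cong₂ _∧'_ (ren-cong eq φ) (ren-cong eq ψ)
  ren-cong eq (φ ∨' ψ)   = cong₂ _∨'_ (ren-cong eq φ) (ren-cong eq ψ)
  ren-cong eq (∀' s φ)   = cong (∀' s) (ren-cong (liftR-cong eq) φ)
  ren-cong eq (∃' s φ)   = cong (∃' s) (ren-cong (liftR-cong eq) φ)

  renT-id  : ∀ {Γ s}  (t : Term Γ s)    → renT (λ v → v) t ≡ t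
  renTs-id : ∀ {Γ ss} (ts : Terms Γ ss) → renTs (λ v → v) ts ≡ ts
  renT-id (var v)    = refl
  renT-id (fun f ts) = cong (fun f) (renTs-id ts)
  renTs-id []       = refl
  renTs-id (t ∷ ts) = cong₂ _∷_ (renT-id t) (renTs-id ts)

  ren-id : ∀ {Γ} (φ : Formula Γ) → ren (λ v → v) φ ≡ φ
  ren-id ⊥'         = refl
  ren-id (rel r ts) = cong (rel r) (renTs-id ts)
  ren-id (t ≐ u)    = cong₂ _≐_ (renT-id t) (renT-id u)
  ren-id (φ ⇒ ψ)    = cong₂ _⇒_ (ren-id φ) (ren-id ψ)
  ren-id (φ ∧' ψ)   = cong₂ _∧'_ (ren-id φ) (ren-id ψ)
  ren-id (φ ∨' ψ)   = cong₂ _∨'_ (ren-id φ) (ren-id ψ)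
  ren-id (∀' s φ)   = cong (∀' s) (trans (ren-cong liftR-id φ) (ren-id φ))
  ren-id (∃' s φ)   = cong (∃' s) (trans (ren-cong liftR-id φ) (ren-id φ))

  renT-∘  : ∀ {Γ Δ Θ s} (σ : Ren Δ Θ) (ρ : Ren Γ Δ) (t : Term Γ s) →
            renT σ (renT ρ t) ≡ renT (λ v → σ (ρ v)) t
  renTs-∘ : ∀ {Γ Δ Θ ss} (σ : Ren Δ Θ) (ρ : Ren Γ Δ) (ts : Terms Γ ss) →
            renTs σ (renTs ρ ts) ≡ renTs (λ v → σ (ρ v)) ts
  renT-∘ σ ρ (var v)    = refl
  renT-∘ σ ρ (fun f ts) = cong (fun f) (renTs-∘ σ ρ ts)
  renTs-∘ σ ρ []       = refl
  renTs-∘ σ ρ (t ∷ ts) = cong₂ _∷_ (renT-∘ σ ρ t) (renTs-∘ σ ρ ts)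

  ren-∘ : ∀ {Γ Δ Θ} (σ : Ren Δ Θ) (ρ : Ren Γ Δ) (φ : Formula Γ) →
          ren σ (ren ρ φ) ≡ ren (λ v → σ (ρ v)) φ
  ren-∘ σ ρ ⊥'         = refl
  ren-∘ σ ρ (rel r ts) = cong (rel r) (renTs-∘ σ ρ ts)
  ren-∘ σ ρ (t ≐ u)    = cong₂ _≐_ (renT-∘ σ ρ t) (renT-∘ σ ρ u)
  ren-∘ σ ρ (φ ⇒ ψ)    = cong₂ _⇒_ (ren-∘ σ ρ φ) (ren-∘ σ ρ ψ)
  ren-∘ σ ρ (φ ∧' ψ)   = cong₂ _∧'_ (ren-∘ σ ρ φ) (ren-∘ σ ρ ψ)
  ren-∘ σ ρ (φ ∨' ψ)   = cong₂ _∨'_ (ren-∘ σ ρ φ) (ren-∘ σ ρ ψ)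
  ren-∘ σ ρ (∀' s φ)   = cong (∀' s) (trans (ren-∘ (liftR σ) (liftR ρ) φ) (ren-cong (liftR-∘ σ ρ) φ))
  ren-∘ σ ρ (∃' s φ)   = cong (∃' s) (trans (ren-∘ (liftR σ) (liftR ρ) φ) (ren-cong (liftR-∘ σ ρ) φ))

  subT-cong  : ∀ {Γ Δ s}  {σ σ′ : Sub Γ Δ} → σ ≗ˢ σ′ → (t : Term Γ s) → subT σ t ≡ subT σ′ t
  subTs-cong : ∀ {Γ Δ ss} {σ σ′ : Sub Γ Δ} → σ ≗ˢ σ′ → (ts : Terms Γ ss) → subTs σ ts ≡ subTs σ′ ts
  subT-cong eq (var v)    = eq v
  subT-cong eq (fun f ts) = cong (fun f) (subTs-cong eq ts)
  subTs-cong eq []       = refl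
  subTs-cong eq (t ∷ ts) = cong₂ _∷_ (subT-cong eq t) (subTs-cong eq ts)

  sub-cong : ∀ {Γ Δ} {σ σ′ : Sub Γ Δ} → σ ≗ˢ σ′ → (φ : Formula Γ) → sub σ φ ≡ sub σ′ φ
  sub-cong eq ⊥'         = refl
  sub-cong eq (rel r ts) = cong (rel r) (subTs-cong eq ts)
  sub-cong eq (t ≐ u)    = cong₂ _≐_ (subT-cong eq t) (subT-cong eq u)
  sub-cong eq (φ ⇒ ψ)    = cong₂ _⇒_ (sub-cong eq φ) (sub-cong eq ψ)
  sub-cong eq (φ ∧' ψ)   = cong₂ _∧'_ (sub-cong eq φ) (sub-cong eq ψ)
  sub-cong eq (φ ∨' ψ)   = cong₂ _∨'_ (sub-cong eq φ) (sub-cong eq ψ)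
  sub-cong eq (∀' s φ)   = cong (∀' s) (sub-cong (liftS-cong eq) φ)
  sub-cong eq (∃' s φ)   = cong (∃' s) (sub-cong (liftS-cong eq) φ)

  subT-renT  : ∀ {Γ Δ Θ s} (σ : Sub Δ Θ) (ρ : Ren Γ Δ) (t : Term Γ s) →
               subT σ (renT ρ t) ≡ subT (λ v → σ (ρ v)) t
  subTs-renTs : ∀ {Γ Δ Θ ss} (σ : Sub Δ Θ) (ρ : Ren Γ Δ) (ts : Terms Γ ss) →
                subTs σ (renTs ρ ts) ≡ subTs (λ v → σ (ρ v)) ts
  subT-renT σ ρ (var v)    = refl
  subT-renT σ ρ (fun f ts) = cong (fun f) (subTs-renTs σ ρ ts)
  subTs-renTs σ ρ []       = refl
  subTs-renTs σ ρ (t ∷ ts) = cong₂ _∷_ (subT-renT σ ρ t) (subTs-renTs σ ρ ts)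

  sub-ren : ∀ {Γ Δ Θ} (σ : Sub Δ Θ) (ρ : Ren Γ Δ) (φ : Formula Γ) →
            sub σ (ren ρ φ) ≡ sub (λ v → σ (ρ v)) φ
  sub-ren σ ρ ⊥'         = refl
  sub-ren σ ρ (rel r ts) = cong (rel r) (subTs-renTs σ ρ ts)
  sub-ren σ ρ (t ≐ u)    = cong₂ _≐_ (subT-renT σ ρ t) (subT-renT σ ρ u)
  sub-ren σ ρ (φ ⇒ ψ)    = cong₂ _⇒_ (sub-ren σ ρ φ) (sub-ren σ ρ ψ)
  sub-ren σ ρ (φ ∧' ψ)   = cong₂ _∧'_ (sub-ren σ ρ φ) (sub-ren σ ρ ψ)
  sub-ren σ ρ (φ ∨' ψ)   = cong₂ _∨'_ (sub-ren σ ρ φ) (sub-ren σ ρ ψ)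
  sub-ren σ ρ (∀' s φ)   = cong (∀' s) (trans (sub-ren (liftS σ) (liftR ρ) φ) (sub-cong (liftS-liftR σ ρ) φ))
  sub-ren σ ρ (∃' s φ)   = cong (∃' s) (trans (sub-ren (liftS σ) (liftR ρ) φ) (sub-cong (liftS-liftR σ ρ) φ))

  renT-subT  : ∀ {Γ Δ Θ s} (ρ : Ren Δ Θ) (σ : Sub Γ Δ) (t : Term Γ s) →
               renT ρ (subT σ t) ≡ subT (λ v → renT ρ (σ v)) t
  renTs-subTs : ∀ {Γ Δ Θ ss} (ρ : Ren Δ Θ) (σ : Sub Γ Δ) (ts : Terms Γ ss) →
                renTs ρ (subTs σ ts) ≡ subTs (λ v → renT ρ (σ v)) ts
  renT-subT ρ σ (var v)    = refl
  renT-subT ρ σ (fun f ts) = cong (fun f) (renTs-subTs ρ σ ts)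
  renTs-subTs ρ σ []       = refl
  renTs-subTs ρ σ (t ∷ ts) = cong₂ _∷_ (renT-subT ρ σ t) (renTs-subTs ρ σ ts)

  liftR-liftS : ∀ {Γ Δ Θ t} (ρ : Ren Δ Θ) (σ : Sub Γ Δ) →
                (λ {s} (v : (t ∷ Γ) ∋ s) → renT (liftR ρ) (liftS σ v)) ≗ˢ liftS (λ v → renT ρ (σ v))
  liftR-liftS ρ σ here      = refl
  liftR-liftS ρ σ (there v) = trans (renT-∘ (liftR ρ) there (σ v)) (sym (renT-∘ there ρ (σ v)))

  ren-sub : ∀ {Γ Δ Θ} (ρ : Ren Δ Θ) (σ : Sub Γ Δ) (φ : Formula Γ) →
            ren ρ (sub σ φ) ≡ sub (λ v → renT ρ (σ v)) φ
  ren-sub ρ σ ⊥'         = refl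
  ren-sub ρ σ (rel r ts) = cong (rel r) (renTs-subTs ρ σ ts)
  ren-sub ρ σ (t ≐ u)    = cong₂ _≐_ (renT-subT ρ σ t) (renT-subT ρ σ u)
  ren-sub ρ σ (φ ⇒ ψ)    = cong₂ _⇒_ (ren-sub ρ σ φ) (ren-sub ρ σ ψ)
  ren-sub ρ σ (φ ∧' ψ)   = cong₂ _∧'_ (ren-sub ρ σ φ) (ren-sub ρ σ ψ)
  ren-sub ρ σ (φ ∨' ψ)   = cong₂ _∨'_ (ren-sub ρ σ φ) (ren-sub ρ σ ψ)
  ren-sub ρ σ (∀' s φ)   = cong (∀' s) (trans (ren-sub (liftR ρ) (liftS σ) φ) (sub-cong (liftR-liftS ρ σ) φ))
  ren-sub ρ σ (∃' s φ)   = cong (∃' s) (trans (ren-sub (liftR ρ) (liftS σ) φ) (sub-cong (liftR-liftS ρ σ) φ))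

  subT-var  : ∀ {Γ Δ s}  (ρ : Ren Γ Δ) (t : Term Γ s)    → subT (λ v → var (ρ v)) t ≡ renT ρ t
  subTs-var : ∀ {Γ Δ ss} (ρ : Ren Γ Δ) (ts : Terms Γ ss) → subTs (λ v → var (ρ v)) ts ≡ renTs ρ ts
  subT-var ρ (var v)    = refl
  subT-var ρ (fun f ts) = cong (fun f) (subTs-var ρ ts)
  subTs-var ρ []       = refl
  subTs-var ρ (t ∷ ts) = cong₂ _∷_ (subT-var ρ t) (subTs-var ρ ts)

  sub-var : ∀ {Γ Δ} (ρ : Ren Γ Δ) (φ : Formula Γ) → sub (λ v → var (ρ v)) φ ≡ ren ρ φ
  sub-var ρ ⊥'         = refl
  sub-var ρ (rel r ts) = cong (rel r) (subTs-var ρ ts)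
  sub-var ρ (t ≐ u)    = cong₂ _≐_ (subT-var ρ t) (subT-var ρ u)
  sub-var ρ (φ ⇒ ψ)    = cong₂ _⇒_ (sub-var ρ φ) (sub-var ρ ψ)
  sub-var ρ (φ ∧' ψ)   = cong₂ _∧'_ (sub-var ρ φ) (sub-var ρ ψ)
  sub-var ρ (φ ∨' ψ)   = cong₂ _∨'_ (sub-var ρ φ) (sub-var ρ ψ)
  sub-var ρ (∀' s φ)   = cong (∀' s) (trans (sub-cong (liftS-var ρ) φ) (sub-var (liftR ρ) φ))
  sub-var ρ (∃' s φ)   = cong (∃' s) (trans (sub-cong (liftS-var ρ) φ) (sub-var (liftR ρ) φ))

  ren-[] : ∀ {Γ Δ s} (ρ : Ren Γ Δ) (φ : Formula (s ∷ Γ)) (t : Term Γ s) →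
           ren ρ (φ [ t ]) ≡ ren (liftR ρ) φ [ renT ρ t ]
  ren-[] ρ φ t = begin
    ren ρ (sub (sub1 t) φ)                        ≡⟨ ren-sub ρ (sub1 t) φ ⟩
    sub (λ v → renT ρ (sub1 t v)) φ               ≡⟨ sub-cong (λ { here → refl ; (there v) → refl }) φ ⟩
    sub (λ v → sub1 (renT ρ t) (liftR ρ v)) φ     ≡⟨ sub-ren (sub1 (renT ρ t)) (liftR ρ) φ ⟨
    sub (sub1 (renT ρ t)) (ren (liftR ρ) φ)       ∎
    where open ≡-Reasoning

  ren-wk : ∀ {Γ Δ s} (ρ : Ren Γ Δ) (φ : Formula Γ) → ren (liftR {t = s} ρ) (wk φ) ≡ wk (ren ρ φ)
  ren-wk ρ φ = trans (ren-∘ (liftR ρ) there φ) (sym (ren-∘ there ρ φ))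

  map-ren-wk : ∀ {Γ Δ s} (ρ : Ren Γ Δ) (H : List (Formula Γ)) →
               map (ren (liftR {t = s} ρ)) (map wk H) ≡ map wk (map (ren ρ) H)
  map-ren-wk ρ = map-square (ren-wk ρ)

  module _ {T : Theory} where

    weaken : ∀ {Γ H H′ φ} → H ⊆ H′ → Deriv T Γ H φ → Deriv T Γ H′ φ
    weaken H⊆ (hyp p)       = hyp (H⊆ p)
    weaken H⊆ (ax a)        = ax a
    weaken H⊆ (raa d)       = raa (weaken (∷⁺ʳ _ H⊆) d)
    weaken H⊆ (⇒I d)        = ⇒I (weaken (∷⁺ʳ _ H⊆) d)
    weaken H⊆ (⇒E d e)      = ⇒E (weaken H⊆ d) (weaken H⊆ e)
    weaken H⊆ (∧I d e)      = ∧I (weaken H⊆ d) (weaken H⊆ e)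
    weaken H⊆ (∧E₁ d)       = ∧E₁ (weaken H⊆ d)
    weaken H⊆ (∧E₂ d)       = ∧E₂ (weaken H⊆ d)
    weaken H⊆ (∨I₁ d)       = ∨I₁ (weaken H⊆ d)
    weaken H⊆ (∨I₂ d)       = ∨I₂ (weaken H⊆ d)
    weaken H⊆ (∨E d e f)    = ∨E (weaken H⊆ d) (weaken (∷⁺ʳ _ H⊆) e) (weaken (∷⁺ʳ _ H⊆) f)
    weaken H⊆ (∀I d)        = ∀I (weaken (map⁺ wk H⊆) d)
    weaken H⊆ (∀E d t)      = ∀E (weaken H⊆ d) t
    weaken H⊆ (∃I t d)      = ∃I t (weaken H⊆ d)
    weaken H⊆ (∃E d e)      = ∃E (weaken H⊆ d) (weaken (∷⁺ʳ _ (map⁺ wk H⊆)) e)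
    weaken H⊆ (≐refl t)     = ≐refl t
    weaken H⊆ (≐E φ d e)    = ≐E φ (weaken H⊆ d) (weaken H⊆ e)
    weaken H⊆ (inhab s d)   = inhab s (weaken (map⁺ wk H⊆) d)

    rename : ∀ {Γ Δ H φ} (ρ : Ren Γ Δ) → Deriv T Γ H φ → Deriv T Δ (map (ren ρ) H) (ren ρ φ)
    rename ρ (hyp p)       = hyp (∈-map⁺ (ren ρ) p)
    rename ρ (ax {φ = φ} a) =
      subst (Deriv T _ _) (trans (ren-cong (λ ()) φ) (sym (ren-∘ ρ fromEmpty φ))) (ax a)
    rename ρ (raa d)       = raa (rename ρ d)
    rename ρ (⇒I d)        = ⇒I (rename ρ d)
    rename ρ (⇒E d e)      = ⇒E (rename ρ d) (rename ρ e)
    rename ρ (∧I d e)      = ∧I (rename ρ d) (rename ρ e)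
    rename ρ (∧E₁ d)       = ∧E₁ (rename ρ d)
    rename ρ (∧E₂ d)       = ∧E₂ (rename ρ d)
    rename ρ (∨I₁ d)       = ∨I₁ (rename ρ d)
    rename ρ (∨I₂ d)       = ∨I₂ (rename ρ d)
    rename ρ (∨E d e f)    = ∨E (rename ρ d) (rename ρ e) (rename ρ f)
    rename ρ (∀I {H = H} d) =
      ∀I (subst (λ K → Deriv T _ K _) (map-ren-wk ρ H) (rename (liftR ρ) d))
    rename ρ (∀E {φ = φ} d t) =
      subst (Deriv T _ _) (sym (ren-[] ρ φ t)) (∀E (rename ρ d) (renT ρ t))
    rename ρ (∃I {φ = φ} t d) =
      ∃I (renT ρ t) (subst (Deriv T _ _) (ren-[] ρ φ t) (rename ρ d))
    rename ρ (∃E {H = H} {χ = χ} d e) =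
      ∃E (rename ρ d)
         (subst₂ (λ K ψ → Deriv T _ (_ ∷ K) ψ) (map-ren-wk ρ H) (ren-wk ρ χ) (rename (liftR ρ) e))
    rename ρ (≐refl t)     = ≐refl (renT ρ t)
    rename ρ (≐E {t = t} {u = u} φ d e) =
      subst (Deriv T _ _) (sym (ren-[] ρ φ u))
        (≐E (ren (liftR ρ) φ) (rename ρ d) (subst (Deriv T _ _) (ren-[] ρ φ t) (rename ρ e)))
    rename ρ (inhab {H = H} {φ = φ} s d) =
      inhab s (subst₂ (Deriv T _) (map-ren-wk ρ H) (ren-wk ρ φ) (rename (liftR ρ) d))

module TranslationProperties {L : OneSorted} (I : Interpretation L) where
  private
    module S = Syntax (toSig L)
    module SP = SyntaxProperties (toSig L)
  open Interpretation I
  open Translate L I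
  open SP using (_≗ʳ_)

  pairR-injL : ∀ {xs ys Δ} (f : S.Ren xs Δ) (g : S.Ren ys Δ) {s} (v : xs S.∋ s) →
               pairR f g (injL {xs} {ys} v) ≡ f v
  pairR-injL f g S.here      = refl
  pairR-injL f g (S.there v) = pairR-injL (λ w → f (S.there w)) g v

  pairR-injR : ∀ xs {ys Δ} (f : S.Ren xs Δ) (g : S.Ren ys Δ) {s} (v : ys S.∋ s) →
               pairR {xs} f g (injR xs v) ≡ g v
  pairR-injR []       f g v = refl
  pairR-injR (_ ∷ xs) f g v = pairR-injR xs (λ w → f (S.there w)) g v

  pairR-∘ : ∀ {xs ys Δ Θ} (h : S.Ren Δ Θ) (f : S.Ren xs Δ) (g : S.Ren ys Δ) →
            (λ {s} v → h (pairR {xs} f g {s} v)) ≗ʳ pairR {xs} (λ w → h (f w)) (λ w → h (g w))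
  pairR-∘ {[]}     h f g v           = refl
  pairR-∘ {_ ∷ xs} h f g S.here      = refl
  pairR-∘ {_ ∷ xs} h f g (S.there v) = pairR-∘ {xs} h (λ w → f (S.there w)) g v

  pairR-cong : ∀ {xs ys Δ} {f f′ : S.Ren xs Δ} {g g′ : S.Ren ys Δ} →
               f ≗ʳ f′ → g ≗ʳ g′ → pairR {xs} f g ≗ʳ pairR f′ g′
  pairR-cong {[]}     f≗ g≗ v           = g≗ v
  pairR-cong {_ ∷ xs} f≗ g≗ S.here      = f≗ S.here
  pairR-cong {_ ∷ xs} f≗ g≗ (S.there v) = pairR-cong {xs} (λ w → f≗ (S.there w)) g≗ v

  pairR-injL-injR : ∀ xs {ys} → pairR {xs} {ys} injL (injR xs) ≗ʳ (λ v → v)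
  pairR-injL-injR []       v           = refl
  pairR-injL-injR (_ ∷ xs) S.here      = refl
  pairR-injL-injR (_ ∷ xs) {ys} (S.there v) =
    trans (sym (pairR-∘ {xs} {ys} S.there injL (injR xs) v)) (cong S.there (pairR-injL-injR xs v))

  liftBlock : ∀ {xs Γ Δ} → S.Ren Γ Δ → S.Ren (xs ++ Γ) (xs ++ Δ)
  liftBlock {xs} ρ = pairR {xs} injL (λ v → injR xs (ρ v))

  liftR-liftBlock : ∀ n {Γ Δ} (ρ : S.Ren Γ Δ) →
                    S.liftR {t = tt} (liftBlock {ctx n} ρ) ≗ʳ liftBlock {ctx (suc n)} ρ
  liftR-liftBlock n ρ S.here      = refl
  liftR-liftBlock n ρ (S.there v) = pairR-∘ {ctx n} S.there injL _ v

  ren-∀ⁿ : ∀ n {Γ Δ} (ρ : S.Ren Γ Δ) (φ : S.Formula (ctx n ++ Γ)) →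
           S.ren ρ (∀ⁿ n φ) ≡ ∀ⁿ n (S.ren (liftBlock {ctx n} ρ) φ)
  ren-∀ⁿ zero    ρ φ = refl
  ren-∀ⁿ (suc n) ρ φ =
    trans (ren-∀ⁿ n ρ (S.∀' tt φ)) (cong (λ ψ → ∀ⁿ n (S.∀' tt ψ)) (SP.ren-cong (liftR-liftBlock n ρ) φ))

  ren-∃ⁿ : ∀ n {Γ Δ} (ρ : S.Ren Γ Δ) (φ : S.Formula (ctx n ++ Γ)) →
           S.ren ρ (∃ⁿ n φ) ≡ ∃ⁿ n (S.ren (liftBlock {ctx n} ρ) φ)
  ren-∃ⁿ zero    ρ φ = refl
  ren-∃ⁿ (suc n) ρ φ =
    trans (ren-∃ⁿ n ρ (S.∃' tt φ)) (cong (λ ψ → ∃ⁿ n (S.∃' tt ψ)) (SP.ren-cong (liftR-liftBlock n ρ) φ))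

  expand : ∀ {Γ Δ} → AC.Ren Γ Δ → S.Ren (ctx* Γ) (ctx* Δ)
  expand {[]}    σ ()
  expand {s ∷ Γ} σ = pairR (varT (σ AC.here)) (expand (λ v → σ (AC.there v)))

  expand-varT : ∀ {Γ Δ s} (σ : AC.Ren Γ Δ) (x : Γ AC.∋ s) (w : ctx (dim s) S.∋ tt) →
                expand σ (varT x w) ≡ varT (σ x) w
  expand-varT σ AC.here w = pairR-injL (varT (σ AC.here)) _ w
  expand-varT {t ∷ Γ} σ (AC.there x) w =
    trans (pairR-injR (ctx (dim t)) (varT (σ AC.here)) _ (varT x w)) (expand-varT (λ v → σ (AC.there v)) x w)

  expand-there : ∀ {Γ Δ t} (σ : AC.Ren Γ Δ) →
                 expand (λ v → AC.there {t = t} (σ v)) ≗ʳ (λ u → injR (ctx (dim t)) (expand σ u))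
  expand-there {[]}        σ ()
  expand-there {s ∷ Γ} {t = t} σ v =
    trans (pairR-cong {ctx (dim s)} (λ w → refl) (expand-there (λ u → σ (AC.there u))) v)
          (sym (pairR-∘ {ctx (dim s)} (injR (ctx (dim t))) (varT (σ AC.here)) _ v))

  expand-id : ∀ {Γ} → expand {Γ} (λ v → v) ≗ʳ (λ v → v)
  expand-id {[]}    ()
  expand-id {s ∷ Γ} v =
    trans (pairR-cong {ctx (dim s)} (λ w → refl)
                      (λ u → trans (expand-there {Γ} (λ x → x) u) (cong (injR (ctx (dim s))) (expand-id {Γ} u))) v)
          (pairR-injL-injR (ctx (dim s)) v)

  expand-liftR : ∀ {Γ Δ s} (σ : AC.Ren Γ Δ) → expand (AC.liftR {t = s} σ) ≗ʳ liftBlock {ctx (dim s)} (expand σ)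
  expand-liftR {s = s} σ = pairR-cong {ctx (dim s)} (λ w → refl) (expand-there σ)

module BlockQuantifierRules {L : OneSorted} (I : Interpretation L) (T : Syntax.Theory (toSig L)) where
  open Translate L I
  private
    module S = Syntax (toSig L)
    module SP = SyntaxProperties (toSig L)
    D : ∀ Γ → List (S.Formula Γ) → S.Formula Γ → Set
    D = S.Deriv T

    map-ren-id : ∀ {Γ} (H : List (S.Formula Γ)) → map (S.ren (λ v → v)) H ≡ H
    map-ren-id H = trans (map-cong SP.ren-id H) (map-id H)

    ren-injR-suc : ∀ n {Γ} (ψ : S.Formula Γ) → S.ren (injR (ctx (suc n))) ψ ≡ S.wk (S.ren (injR (ctx n)) ψ)
    ren-injR-suc n ψ = sym (SP.ren-∘ S.there (injR (ctx n)) ψ)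

    map-injR-suc : ∀ n {Γ} (H : List (S.Formula Γ)) →
                   map (S.ren (injR (ctx (suc n)))) H ≡ map S.wk (map (S.ren (injR (ctx n))) H)
    map-injR-suc n H = trans (map-cong (ren-injR-suc n) H) (map-∘ H)

    instantiate-block : ∀ n {Γ} (ρ : S.Ren (ctx (suc n)) Γ) (φ : S.Formula (ctx (suc n) ++ Γ)) →
      S.ren (S.liftR (pairR {ctx n} (λ w → ρ (S.there w)) (λ v → v))) φ S.[ S.var (ρ S.here) ]
        ≡ S.ren (pairR {ctx (suc n)} ρ (λ v → v)) φ
    instantiate-block n ρ φ =
      trans (SP.sub-ren _ _ φ) (trans (SP.sub-cong (λ { S.here → refl ; (S.there v) → refl }) φ) (SP.sub-var _ φ))

  ∀ⁿ-I : ∀ n {Γ H φ} → D (ctx n ++ Γ) (map (S.ren (injR (ctx n))) H) φ → D Γ H (∀ⁿ n φ)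
  ∀ⁿ-I zero    {H = H} d = subst (λ K → D _ K _) (map-ren-id H) d
  ∀ⁿ-I (suc n) {H = H} d = ∀ⁿ-I n (S.∀I (subst (λ K → D _ K _) (map-injR-suc n H) d))

  ∀ⁿ-E : ∀ n {Γ H φ} → D Γ H (∀ⁿ n φ) → (ρ : S.Ren (ctx n) Γ) → D Γ H (S.ren (pairR {ctx n} ρ (λ v → v)) φ)
  ∀ⁿ-E zero    {φ = φ} d ρ = subst (D _ _) (sym (SP.ren-id φ)) d
  ∀ⁿ-E (suc n) {φ = φ} d ρ =
    subst (D _ _) (instantiate-block n ρ φ) (S.∀E (∀ⁿ-E n d (λ w → ρ (S.there w))) (S.var (ρ S.here)))

  ∃ⁿ-I : ∀ n {Γ H φ} (ρ : S.Ren (ctx n) Γ) → D Γ H (S.ren (pairR {ctx n} ρ (λ v → v)) φ) → D Γ H (∃ⁿ n φ)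
  ∃ⁿ-I zero    {φ = φ} ρ d = subst (D _ _) (SP.ren-id φ) d
  ∃ⁿ-I (suc n) {φ = φ} ρ d =
    ∃ⁿ-I n (λ w → ρ (S.there w)) (S.∃I (S.var (ρ S.here)) (subst (D _ _) (sym (instantiate-block n ρ φ)) d))

  ∃ⁿ-E : ∀ n {Γ H φ χ} → D Γ H (∃ⁿ n φ) →
         D (ctx n ++ Γ) (φ ∷ map (S.ren (injR (ctx n))) H) (S.ren (injR (ctx n)) χ) → D Γ H χ
  ∃ⁿ-E zero    {H = H} {φ} {χ} d e =
    S.⇒E (S.⇒I (subst₂ (λ K ψ → D _ (φ ∷ K) ψ) (map-ren-id H) (SP.ren-id χ) e)) d
  ∃ⁿ-E (suc n) {H = H} {φ} {χ} d e =
    ∃ⁿ-E n d (S.∃E (S.hyp (Any.here refl))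
      (SP.weaken (∷⁺ʳ φ (xs⊆x∷xs _ _))
        (subst₂ (λ K ψ → D _ (φ ∷ K) ψ) (map-injR-suc n H) (ren-injR-suc n χ) e)))

-- What an o-direct interpretation leaves to choose: everything about the class sort.
record DirectClasses (L : OneSorted) : Set where
  open Syntax (toSig L) using (Formula)
  field
    dimᶜ      : ℕ
    isClass   : Formula (ctx dimᶜ)
    memberOf  : Formula (ctx 1 ++ ctx dimᶜ)
    sameClass : Formula (ctx dimᶜ ++ ctx dimᶜ)

module _ {L : OneSorted} where
  private
    module S = Syntax (toSig L)

  interpretation : (k m : ℕ) → S.Formula (ctx k) → S.Formula (ctx m) → S.Formula (ctx k ++ ctx m)
                 → S.Formula (ctx k ++ ctx k) → S.Formula (ctx m ++ ctx m) → Interpretation L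
  interpretation k m δo δc memberOf eqo eqc = record
    { dim  = λ { o → k ; c → m }
    ; dom  = λ { o → δo ; c → δc }
    ; memT = memberOf
    ; eqT  = λ { o → eqo ; c → eqc }
    }

  direct : DirectClasses L → Interpretation L
  direct C = interpretation 1 dimᶜ (S.var S.here S.≐ S.var S.here) isClass memberOf
                            (S.var S.here S.≐ S.var (S.there S.here)) sameClass
    where open DirectClasses C

module Enriched {L : OneSorted} (C : DirectClasses L) where
  private
    module S = Syntax (toSig L)
    module SP = SyntaxProperties (toSig L)
  open AC using (_∋_; Ren; liftR; here; there)
  open DirectClasses C
  open Interpretation (direct C)
  open Translate L (direct C)
  open TranslationProperties (direct C)

  infixr 6 _∧ᶠ_
  infixr 5 _∨ᶠ_
  infixr 4 _⇒ᶠ_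
  infix 7 _∈ᶠ_ _≐ᶠ_

  -- Formulas of ac over an ac context, in which T-formulas may be applied to objects; they are
  -- translated along the direct interpretation, with quantifiers left unrelativised.
  data Fm (Γ : List SortAC) : Set where
    ⊥ᶠ          : Fm Γ
    _⇒ᶠ_ _∧ᶠ_ _∨ᶠ_ : Fm Γ → Fm Γ → Fm Γ
    ∀ᶠ ∃ᶠ       : (s : SortAC) → Fm (s ∷ Γ) → Fm Γ
    at₁         : S.Formula (ctx 1) → Γ ∋ o → Fm Γ
    at₂         : S.Formula (ctx 2) → Γ ∋ o → Γ ∋ o → Fm Γ
    _∈ᶠ_        : Γ ∋ o → Γ ∋ c → Fm Γ
    _≐ᶠ_        : Γ ∋ o → Γ ∋ o → Fm Γ
    class       : Γ ∋ c → Fm Γ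

  ¬ᶠ : ∀ {Γ} → Fm Γ → Fm Γ
  ¬ᶠ φ = φ ⇒ᶠ ⊥ᶠ

  infix 3 _⇔ᶠ_
  _⇔ᶠ_ : ∀ {Γ} → Fm Γ → Fm Γ → Fm Γ
  φ ⇔ᶠ ψ = (φ ⇒ᶠ ψ) ∧ᶠ (ψ ⇒ᶠ φ)

  ⟦_⟧ : ∀ {Γ} → Fm Γ → S.Formula (ctx* Γ)
  ⟦ ⊥ᶠ ⟧       = S.⊥'
  ⟦ φ ⇒ᶠ ψ ⟧   = ⟦ φ ⟧ S.⇒ ⟦ ψ ⟧
  ⟦ φ ∧ᶠ ψ ⟧   = ⟦ φ ⟧ S.∧' ⟦ ψ ⟧
  ⟦ φ ∨ᶠ ψ ⟧   = ⟦ φ ⟧ S.∨' ⟦ ψ ⟧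
  ⟦ ∀ᶠ s φ ⟧   = ∀ⁿ (dim s) ⟦ φ ⟧
  ⟦ ∃ᶠ s φ ⟧   = ∃ⁿ (dim s) ⟦ φ ⟧
  ⟦ at₁ P x ⟧   = at1 L P (varT x S.here)
  ⟦ at₂ R x y ⟧ = at2 L R (varT x S.here) (varT y S.here)
  ⟦ x ∈ᶠ X ⟧   = S.ren (pairR (varT x) (varT X)) memberOf
  ⟦ x ≐ᶠ y ⟧   = S.ren (pairR (varT x) (varT y)) (eqT o)
  ⟦ class X ⟧  = S.ren (varT X) isClass

  -- Up to definitional equality, the translations of the axioms emptyClass and adjunction:
  -- the guards  class X  and  x ≐ᶠ x  are the relativisations of the quantifiers.
  emptyClassᶠ : Fm []
  emptyClassᶠ = ∃ᶠ c (class here ∧ᶠ ∀ᶠ o (here ≐ᶠ here ⇒ᶠ ¬ᶠ (here ∈ᶠ there here)))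

  adjunctionᶠ : Fm []
  adjunctionᶠ =
    ∀ᶠ c (class here ⇒ᶠ ∀ᶠ o (here ≐ᶠ here ⇒ᶠ ∃ᶠ c (class here ∧ᶠ ∀ᶠ o (here ≐ᶠ here ⇒ᶠ
      (here ∈ᶠ there here
        ⇔ᶠ here ∈ᶠ there (there (there here)) ∨ᶠ here ≐ᶠ there (there here))))))

  renᶠ : ∀ {Γ Δ} → Ren Γ Δ → Fm Γ → Fm Δ
  renᶠ σ ⊥ᶠ          = ⊥ᶠ
  renᶠ σ (φ ⇒ᶠ ψ)    = renᶠ σ φ ⇒ᶠ renᶠ σ ψ
  renᶠ σ (φ ∧ᶠ ψ)    = renᶠ σ φ ∧ᶠ renᶠ σ ψ
  renᶠ σ (φ ∨ᶠ ψ)    = renᶠ σ φ ∨ᶠ renᶠ σ ψ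
  renᶠ σ (∀ᶠ s φ)    = ∀ᶠ s (renᶠ (liftR σ) φ)
  renᶠ σ (∃ᶠ s φ)    = ∃ᶠ s (renᶠ (liftR σ) φ)
  renᶠ σ (at₁ P x)   = at₁ P (σ x)
  renᶠ σ (at₂ R x y) = at₂ R (σ x) (σ y)
  renᶠ σ (x ∈ᶠ X)    = σ x ∈ᶠ σ X
  renᶠ σ (x ≐ᶠ y)    = σ x ≐ᶠ σ y
  renᶠ σ (class X)   = class (σ X)

  wkᶠ : ∀ {Γ s} → Fm Γ → Fm (s ∷ Γ)
  wkᶠ = renᶠ there

  sub1ʳ : ∀ {Γ s} → Γ ∋ s → Ren (s ∷ Γ) Γ
  sub1ʳ x here      = x
  sub1ʳ x (there v) = v

  infix 8 _[_]ᶠ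
  _[_]ᶠ : ∀ {Γ s} → Fm (s ∷ Γ) → Γ ∋ s → Fm Γ
  φ [ x ]ᶠ = renᶠ (sub1ʳ x) φ

  pair : ∀ {Γ} → Γ ∋ o → Γ ∋ o → Ren (o ∷ o ∷ []) Γ
  pair x y here                  = x
  pair x y (there here)       = y
  pair x y (there (there ()))

  private
    ren-pairR-varT : ∀ {Γ Δ s t} (σ : Ren Γ Δ) (x : Γ ∋ s) (y : Γ ∋ t) φ →
      S.ren (pairR (varT (σ x)) (varT (σ y))) φ ≡ S.ren (expand σ) (S.ren (pairR (varT x) (varT y)) φ)
    ren-pairR-varT σ x y φ = sym (trans (SP.ren-∘ (expand σ) (pairR (varT x) (varT y)) φ)
      (SP.ren-cong (λ v → trans (pairR-∘ (expand σ) (varT x) (varT y) v)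
                                (pairR-cong (expand-varT σ x) (expand-varT σ y) v)) φ))

  ⟦⟧-ren : ∀ {Γ Δ} (σ : Ren Γ Δ) (φ : Fm Γ) → ⟦ renᶠ σ φ ⟧ ≡ S.ren (expand σ) ⟦ φ ⟧
  ⟦⟧-ren σ ⊥ᶠ       = refl
  ⟦⟧-ren σ (φ ⇒ᶠ ψ) = cong₂ S._⇒_ (⟦⟧-ren σ φ) (⟦⟧-ren σ ψ)
  ⟦⟧-ren σ (φ ∧ᶠ ψ) = cong₂ S._∧'_ (⟦⟧-ren σ φ) (⟦⟧-ren σ ψ)
  ⟦⟧-ren σ (φ ∨ᶠ ψ) = cong₂ S._∨'_ (⟦⟧-ren σ φ) (⟦⟧-ren σ ψ)
  ⟦⟧-ren σ (∀ᶠ s φ) =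
    trans (cong (∀ⁿ (dim s)) (trans (⟦⟧-ren (liftR σ) φ) (SP.ren-cong (expand-liftR σ) ⟦ φ ⟧)))
          (sym (ren-∀ⁿ (dim s) (expand σ) ⟦ φ ⟧))
  ⟦⟧-ren σ (∃ᶠ s φ) =
    trans (cong (∃ⁿ (dim s)) (trans (⟦⟧-ren (liftR σ) φ) (SP.ren-cong (expand-liftR σ) ⟦ φ ⟧)))
          (sym (ren-∃ⁿ (dim s) (expand σ) ⟦ φ ⟧))
  ⟦⟧-ren σ (at₁ P x) =
    trans (SP.ren-cong (λ { S.here → sym (expand-varT σ x S.here) ; (S.there ()) }) P)
          (sym (SP.ren-∘ (expand σ) _ P))
  ⟦⟧-ren σ (at₂ R x y) =
    trans (SP.ren-cong (λ { S.here → sym (expand-varT σ x S.here)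
                          ; (S.there S.here) → sym (expand-varT σ y S.here)
                          ; (S.there (S.there ())) }) R)
          (sym (SP.ren-∘ (expand σ) _ R))
  ⟦⟧-ren σ (x ∈ᶠ X)  = ren-pairR-varT σ x X memberOf
  ⟦⟧-ren σ (x ≐ᶠ y)  = ren-pairR-varT σ x y (eqT o)
  ⟦⟧-ren σ (class X) = sym (trans (SP.ren-∘ (expand σ) (varT X) isClass) (SP.ren-cong (expand-varT σ X) isClass))

  ⟦⟧-wk : ∀ {Γ s} (φ : Fm Γ) → ⟦ wkᶠ {s = s} φ ⟧ ≡ S.ren (injR (ctx (dim s))) ⟦ φ ⟧
  ⟦⟧-wk {Γ} {s} φ =
    trans (⟦⟧-ren there φ)
          (SP.ren-cong (λ u → trans (expand-there {Γ} (λ v → v) u) (cong (injR (ctx (dim s))) (expand-id {Γ} u))) ⟦ φ ⟧)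

  ⟦⟧-[] : ∀ {Γ s} (φ : Fm (s ∷ Γ)) (x : Γ ∋ s) →
          ⟦ φ [ x ]ᶠ ⟧ ≡ S.ren (pairR {ctx (dim s)} (varT x) (λ v → v)) ⟦ φ ⟧
  ⟦⟧-[] {Γ} {s} φ x = trans (⟦⟧-ren _ φ) (SP.ren-cong (pairR-cong {ctx (dim s)} (λ w → refl) (expand-id {Γ})) ⟦ φ ⟧)

  ⟦⟧-[]ᵒ : ∀ {Γ} (φ : Fm (o ∷ Γ)) (x : Γ ∋ o) → ⟦ φ [ x ]ᶠ ⟧ ≡ ⟦ φ ⟧ S.[ S.var (varT x S.here) ]
  ⟦⟧-[]ᵒ φ x = trans (⟦⟧-[] φ x)
    (sym (trans (SP.sub-cong (λ { S.here → refl ; (S.there v) → refl }) ⟦ φ ⟧) (SP.sub-var _ ⟦ φ ⟧)))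

  ⟦⟧-pair : ∀ {Γ} (ψ : Fm (o ∷ o ∷ [])) (x y : Γ ∋ o) →
            ⟦ renᶠ (pair x y) ψ ⟧ ≡ at2 L ⟦ ψ ⟧ (varT x S.here) (varT y S.here)
  ⟦⟧-pair ψ x y = trans (⟦⟧-ren _ ψ)
    (SP.ren-cong (λ { S.here → refl ; (S.there S.here) → refl ; (S.there (S.there ())) }) ⟦ ψ ⟧)

  module Proofs (T : S.Theory) where
    private
      D : ∀ Γ → List (S.Formula Γ) → S.Formula Γ → Set
      D = S.Deriv T
      open BlockQuantifierRules (direct C) T

      map-⟦⟧-wk : ∀ {Γ s} (Φ : List (Fm Γ)) →
                  map ⟦_⟧ (map (wkᶠ {s = s}) Φ) ≡ map (S.ren (injR (ctx (dim s)))) (map ⟦_⟧ Φ)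
      map-⟦⟧-wk = map-square ⟦⟧-wk

      map-⟦⟧-ren : ∀ {Γ Δ} (σ : Ren Γ Δ) (Φ : List (Fm Γ)) →
                   map ⟦_⟧ (map (renᶠ σ) Φ) ≡ map (S.ren (expand σ)) (map ⟦_⟧ Φ)
      map-⟦⟧-ren σ = map-square (⟦⟧-ren σ)

    infix 2 _∣_⊢_

    -- A record rather than a synonym for D, so that Φ and φ can be inferred from a derivation.
    record _∣_⊢_ (Γ : List SortAC) (Φ : List (Fm Γ)) (φ : Fm Γ) : Set where
      constructor ⟨_⟩
      field derivation : D (ctx* Γ) (map ⟦_⟧ Φ) ⟦ φ ⟧
    open _∣_⊢_ public

    proves : ∀ {φ} → [] ∣ [] ⊢ φ → S.Proves T ⟦ φ ⟧
    proves = derivation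

    hyp : ∀ {Γ Φ φ} → φ ∈ Φ → Γ ∣ Φ ⊢ φ
    hyp p = ⟨ S.hyp (∈-map⁺ ⟦_⟧ p) ⟩

    weaken : ∀ {Γ Φ Φ′ φ} → Φ ⊆ Φ′ → Γ ∣ Φ ⊢ φ → Γ ∣ Φ′ ⊢ φ
    weaken Φ⊆ ⟨ d ⟩ = ⟨ SP.weaken (map⁺ ⟦_⟧ Φ⊆) d ⟩

    rename : ∀ {Γ Δ Φ φ} (σ : Ren Γ Δ) → Γ ∣ Φ ⊢ φ → Δ ∣ map (renᶠ σ) Φ ⊢ renᶠ σ φ
    rename {Φ = Φ} {φ} σ ⟨ d ⟩ = ⟨ subst₂ (D _) (sym (map-⟦⟧-ren σ Φ)) (sym (⟦⟧-ren σ φ)) (SP.rename (expand σ) d) ⟩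

    closed : ∀ {Γ Φ} (ψ : Fm []) → S.Proves T ⟦ ψ ⟧ → Γ ∣ Φ ⊢ renᶠ AC.fromEmpty ψ
    closed ψ d = ⟨ SP.weaken (λ ()) (subst (D _ _)
      (trans (SP.ren-cong (λ ()) ⟦ ψ ⟧) (sym (⟦⟧-ren AC.fromEmpty ψ))) (SP.rename S.fromEmpty d)) ⟩

    raa : ∀ {Γ Φ φ} → Γ ∣ ¬ᶠ φ ∷ Φ ⊢ ⊥ᶠ → Γ ∣ Φ ⊢ φ
    raa ⟨ d ⟩ = ⟨ S.raa d ⟩

    ⇒I : ∀ {Γ Φ φ ψ} → Γ ∣ φ ∷ Φ ⊢ ψ → Γ ∣ Φ ⊢ φ ⇒ᶠ ψ
    ⇒I ⟨ d ⟩ = ⟨ S.⇒I d ⟩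

    ⇒E : ∀ {Γ Φ φ ψ} → Γ ∣ Φ ⊢ φ ⇒ᶠ ψ → Γ ∣ Φ ⊢ φ → Γ ∣ Φ ⊢ ψ
    ⇒E ⟨ d ⟩ ⟨ e ⟩ = ⟨ S.⇒E d e ⟩

    ∧I : ∀ {Γ Φ φ ψ} → Γ ∣ Φ ⊢ φ → Γ ∣ Φ ⊢ ψ → Γ ∣ Φ ⊢ φ ∧ᶠ ψ
    ∧I ⟨ d ⟩ ⟨ e ⟩ = ⟨ S.∧I d e ⟩

    ∧E₁ : ∀ {Γ Φ φ ψ} → Γ ∣ Φ ⊢ φ ∧ᶠ ψ → Γ ∣ Φ ⊢ φ
    ∧E₁ ⟨ d ⟩ = ⟨ S.∧E₁ d ⟩

    ∧E₂ : ∀ {Γ Φ φ ψ} → Γ ∣ Φ ⊢ φ ∧ᶠ ψ → Γ ∣ Φ ⊢ ψ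
    ∧E₂ ⟨ d ⟩ = ⟨ S.∧E₂ d ⟩

    ∨I₁ : ∀ {Γ Φ φ} ψ → Γ ∣ Φ ⊢ φ → Γ ∣ Φ ⊢ φ ∨ᶠ ψ
    ∨I₁ ψ ⟨ d ⟩ = ⟨ S.∨I₁ d ⟩

    ∨I₂ : ∀ {Γ Φ ψ} φ → Γ ∣ Φ ⊢ ψ → Γ ∣ Φ ⊢ φ ∨ᶠ ψ
    ∨I₂ φ ⟨ d ⟩ = ⟨ S.∨I₂ d ⟩

    ∨E : ∀ {Γ Φ φ ψ χ} → Γ ∣ Φ ⊢ φ ∨ᶠ ψ → Γ ∣ φ ∷ Φ ⊢ χ → Γ ∣ ψ ∷ Φ ⊢ χ → Γ ∣ Φ ⊢ χ
    ∨E ⟨ d ⟩ ⟨ e ⟩ ⟨ f ⟩ = ⟨ S.∨E d e f ⟩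

    ∀I : ∀ {Γ Φ s φ} → s ∷ Γ ∣ map wkᶠ Φ ⊢ φ → Γ ∣ Φ ⊢ ∀ᶠ s φ
    ∀I {Φ = Φ} {s} ⟨ d ⟩ = ⟨ ∀ⁿ-I (dim s) (subst (λ K → D _ K _) (map-⟦⟧-wk Φ) d) ⟩

    ∀E : ∀ {Γ Φ s φ} → Γ ∣ Φ ⊢ ∀ᶠ s φ → (x : Γ ∋ s) → Γ ∣ Φ ⊢ φ [ x ]ᶠ
    ∀E {s = s} {φ} ⟨ d ⟩ x = ⟨ subst (D _ _) (sym (⟦⟧-[] φ x)) (∀ⁿ-E (dim s) d (varT x)) ⟩

    ∃I : ∀ {Γ Φ s} φ (x : Γ ∋ s) → Γ ∣ Φ ⊢ φ [ x ]ᶠ → Γ ∣ Φ ⊢ ∃ᶠ s φ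
    ∃I {s = s} φ x ⟨ d ⟩ = ⟨ ∃ⁿ-I (dim s) (varT x) (subst (D _ _) (⟦⟧-[] φ x) d) ⟩

    ∃E : ∀ {Γ Φ s φ} χ → Γ ∣ Φ ⊢ ∃ᶠ s φ → s ∷ Γ ∣ φ ∷ map wkᶠ Φ ⊢ wkᶠ χ → Γ ∣ Φ ⊢ χ
    ∃E {Φ = Φ} {s} {φ} χ ⟨ d ⟩ ⟨ e ⟩ =
      ⟨ ∃ⁿ-E (dim s) d (subst₂ (λ K ψ → D _ (⟦ φ ⟧ ∷ K) ψ) (map-⟦⟧-wk Φ) (⟦⟧-wk χ) e) ⟩

    ≐-refl : ∀ {Γ Φ} (x : Γ ∋ o) → Γ ∣ Φ ⊢ x ≐ᶠ x
    ≐-refl x = ⟨ S.≐refl _ ⟩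

    -- o-directness: object identity is translated as identity of T, so T's substitution rule applies.
    ≐-subst : ∀ {Γ Φ} {x y : Γ ∋ o} (φ : Fm (o ∷ Γ)) → Γ ∣ Φ ⊢ x ≐ᶠ y → Γ ∣ Φ ⊢ φ [ x ]ᶠ → Γ ∣ Φ ⊢ φ [ y ]ᶠ
    ≐-subst {x = x} {y} φ ⟨ d ⟩ ⟨ e ⟩ =
      ⟨ subst (D _ _) (sym (⟦⟧-[]ᵒ φ y)) (S.≐E ⟦ φ ⟧ d (subst (D _ _) (⟦⟧-[]ᵒ φ x) e)) ⟩

    fold : ∀ {Γ Φ} (ψ : Fm (o ∷ o ∷ [])) (x y : Γ ∋ o) → Γ ∣ Φ ⊢ renᶠ (pair x y) ψ → Γ ∣ Φ ⊢ at₂ ⟦ ψ ⟧ x y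
    fold ψ x y ⟨ d ⟩ = ⟨ subst (D _ _) (⟦⟧-pair ψ x y) d ⟩

    unfold : ∀ {Γ Φ} (ψ : Fm (o ∷ o ∷ [])) (x y : Γ ∋ o) → Γ ∣ Φ ⊢ at₂ ⟦ ψ ⟧ x y → Γ ∣ Φ ⊢ renᶠ (pair x y) ψ
    unfold ψ x y ⟨ d ⟩ = ⟨ subst (D _ _) (sym (⟦⟧-pair ψ x y)) d ⟩

    h₀ : ∀ {Γ φ Φ} → Γ ∣ φ ∷ Φ ⊢ φ
    h₀ = hyp (Any.here refl)

    h₁ : ∀ {Γ φ ψ Φ} → Γ ∣ ψ ∷ φ ∷ Φ ⊢ φ
    h₁ = hyp (Any.there (Any.here refl))

    h₂ : ∀ {Γ φ ψ χ Φ} → Γ ∣ χ ∷ ψ ∷ φ ∷ Φ ⊢ φ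
    h₂ = hyp (Any.there (Any.there (Any.here refl)))

    h₃ : ∀ {Γ φ ψ χ κ Φ} → Γ ∣ κ ∷ χ ∷ ψ ∷ φ ∷ Φ ⊢ φ
    h₃ = hyp (Any.there (Any.there (Any.there (Any.here refl))))

    h₄ : ∀ {Γ φ ψ χ κ ι Φ} → Γ ∣ ι ∷ κ ∷ χ ∷ ψ ∷ φ ∷ Φ ⊢ φ
    h₄ = hyp (Any.there (Any.there (Any.there (Any.there (Any.here refl)))))

    ↑ʰ : ∀ {Γ Φ φ ψ} → Γ ∣ Φ ⊢ φ → Γ ∣ ψ ∷ Φ ⊢ φ
    ↑ʰ = weaken (xs⊆x∷xs _ _)

    ↑ : ∀ {Γ Φ φ s ψ} → Γ ∣ Φ ⊢ φ → s ∷ Γ ∣ ψ ∷ map wkᶠ Φ ⊢ wkᶠ φ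
    ↑ d = ↑ʰ (rename there d)

    contradiction : ∀ {Γ Φ φ ψ} → Γ ∣ Φ ⊢ φ → Γ ∣ Φ ⊢ ¬ᶠ φ → Γ ∣ Φ ⊢ ψ
    contradiction d ¬d = raa (↑ʰ (⇒E ¬d d))

    by-cases : ∀ {Γ Φ χ} (φ : Fm Γ) → Γ ∣ φ ∷ Φ ⊢ χ → Γ ∣ ¬ᶠ φ ∷ Φ ⊢ χ → Γ ∣ Φ ⊢ χ
    by-cases φ = ∨E (raa (⇒E h₀ (∨I₂ φ (⇒I (⇒E h₁ (∨I₁ _ h₀))))))

    ≐-sym : ∀ {Γ Φ} {x y : Γ ∋ o} → Γ ∣ Φ ⊢ x ≐ᶠ y → Γ ∣ Φ ⊢ y ≐ᶠ x
    ≐-sym {x = x} d = ≐-subst (here ≐ᶠ there x) d (≐-refl x)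

    module EquivalenceRules {P E} (isEquiv : EquivRelOn L T P E) where
      E-refl : ∀ {Γ Φ} {x : Γ ∋ o} → Γ ∣ Φ ⊢ at₁ P x → Γ ∣ Φ ⊢ at₂ E x x
      E-refl {x = x} = ⇒E (∀E (closed (∀ᶠ o (at₁ P here ⇒ᶠ at₂ E here here))
                                       (proj₁ (proj₂ isEquiv))) x)

      E-sym : ∀ {Γ Φ} {x y : Γ ∋ o} → Γ ∣ Φ ⊢ at₂ E x y → Γ ∣ Φ ⊢ at₂ E y x
      E-sym {x = x} {y} = ⇒E (∀E (∀E (closed (∀ᶠ o (∀ᶠ o (at₂ E (there here) here ⇒ᶠ at₂ E here (there here))))
                                               (proj₁ (proj₂ (proj₂ isEquiv)))) x) y)

      E-trans : ∀ {Γ Φ} {x y z : Γ ∋ o} → Γ ∣ Φ ⊢ at₂ E x y → Γ ∣ Φ ⊢ at₂ E y z → Γ ∣ Φ ⊢ at₂ E x z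
      E-trans {x = x} {y} {z} d e =
        ⇒E (∀E (∀E (∀E (closed (∀ᶠ o (∀ᶠ o (∀ᶠ o (at₂ E (there (there here)) (there here) ∧ᶠ at₂ E (there here) here
                                                   ⇒ᶠ at₂ E (there (there here)) here))))
                               (proj₂ (proj₂ (proj₂ isEquiv)))) x) y) z)
           (∧I d e)

    module InjectionRules {P EP Q EQ R} (isInj : Injection L T P EP Q EQ R) where
      R-dom : ∀ {Γ Φ} {x y : Γ ∋ o} → Γ ∣ Φ ⊢ at₂ R x y → Γ ∣ Φ ⊢ at₁ P x
      R-dom {x = x} {y} d =
        ∧E₁ (⇒E (∀E (∀E (closed (∀ᶠ o (∀ᶠ o (at₂ R (there here) here ⇒ᶠ at₁ P (there here) ∧ᶠ at₁ Q here)))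
                                (proj₁ isInj)) x) y) d)

      R-cod : ∀ {Γ Φ} {x y : Γ ∋ o} → Γ ∣ Φ ⊢ at₂ R x y → Γ ∣ Φ ⊢ at₁ Q y
      R-cod {x = x} {y} d =
        ∧E₂ (⇒E (∀E (∀E (closed (∀ᶠ o (∀ᶠ o (at₂ R (there here) here ⇒ᶠ at₁ P (there here) ∧ᶠ at₁ Q here)))
                                (proj₁ isInj)) x) y) d)

      R-resp : ∀ {Γ Φ} {x x′ y′ y : Γ ∋ o} →
               Γ ∣ Φ ⊢ at₂ EP x x′ → Γ ∣ Φ ⊢ at₂ R x′ y′ → Γ ∣ Φ ⊢ at₂ EQ y′ y → Γ ∣ Φ ⊢ at₂ R x y
      R-resp {x = x} {x′} {y′} {y} d e f =
        ⇒E (∀E (∀E (∀E (∀E (closed (∀ᶠ o (∀ᶠ o (∀ᶠ o (∀ᶠ o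
             (at₂ EP (there (there (there here))) (there (there here)) ∧ᶠ at₂ R (there (there here)) (there here)
                ∧ᶠ at₂ EQ (there here) here ⇒ᶠ at₂ R (there (there (there here))) here)))))
           (proj₁ (proj₂ isInj))) x) x′) y′) y)
           (∧I d (∧I e f))

      R-total : ∀ {Γ Φ} {x : Γ ∋ o} → Γ ∣ Φ ⊢ at₁ P x → Γ ∣ Φ ⊢ ∃ᶠ o (at₂ R (there x) here)
      R-total {x = x} = ⇒E (∀E (closed (∀ᶠ o (at₁ P here ⇒ᶠ ∃ᶠ o (at₂ R (there here) here)))
                                        (proj₁ (proj₂ (proj₂ isInj)))) x)

      R-functional : ∀ {Γ Φ} {x y y′ : Γ ∋ o} →
                     Γ ∣ Φ ⊢ at₂ R x y → Γ ∣ Φ ⊢ at₂ R x y′ → Γ ∣ Φ ⊢ at₂ EQ y y′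
      R-functional {x = x} {y} {y′} d e =
        ⇒E (∀E (∀E (∀E (closed (∀ᶠ o (∀ᶠ o (∀ᶠ o
             (at₂ R (there (there here)) (there here) ∧ᶠ at₂ R (there (there here)) here ⇒ᶠ at₂ EQ (there here) here))))
           (proj₁ (proj₂ (proj₂ (proj₂ isInj))))) x) y) y′)
           (∧I d e)

      R-injective : ∀ {Γ Φ} {x x′ y : Γ ∋ o} →
                    Γ ∣ Φ ⊢ at₂ R x y → Γ ∣ Φ ⊢ at₂ R x′ y → Γ ∣ Φ ⊢ at₂ EP x x′
      R-injective {x = x} {x′} {y} d e =
        ⇒E (∀E (∀E (∀E (closed (∀ᶠ o (∀ᶠ o (∀ᶠ o
             (at₂ R (there (there here)) here ∧ᶠ at₂ R (there here) here ⇒ᶠ at₂ EP (there (there here)) (there here)))))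
           (proj₂ (proj₂ (proj₂ (proj₂ isInj))))) x) x′) y)
           (∧I d e)

ProvesClassAxioms : ∀ {L} → Syntax.Theory (toSig L) → DirectClasses L → Set
ProvesClassAxioms {L} T C = Proves T ⟦ emptyClassᶠ ⟧ × Proves T ⟦ adjunctionᶠ ⟧
  where
  open Syntax (toSig L) using (Proves)
  open Enriched C using (⟦_⟧; emptyClassᶠ; adjunctionᶠ)

module _ {L : OneSorted} {T : Syntax.Theory (toSig L)} where
  private
    module S = Syntax (toSig L)

  conceptual⇒directClasses : Conceptual L T → Σ (DirectClasses L) (ProvesClassAxioms T)
  conceptual⇒directClasses (I , (dimᵒ≡1 , domᵒ≡ , eqᵒ≡) , interprets) =
    normalise (dim o) (dom o) (eqT o) memT dimᵒ≡1 domᵒ≡ eqᵒ≡ (interprets _ (AC.ax emptyClass)) (interprets _ (AC.ax adjunction))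
    where
    open Interpretation I

    ProvesAxiom : Interpretation L → ∀ {φ} → acAxioms φ → Set
    ProvesAxiom J {φ} _ = S.Proves T (Translate.tr L J (AC.ren {Δ = []} AC.fromEmpty φ))

    -- Once the equations of o-directness are matched against refl, the translated axioms
    -- compute to ⟦ emptyClassᶠ ⟧ and ⟦ adjunctionᶠ ⟧.
    normalise : ∀ k δo eqo (member : S.Formula (ctx k ++ ctx (dim c))) (k≡1 : k ≡ 1) →
      δo ≡ subst (λ n → S.Formula (ctx n)) (sym k≡1) (S.var S.here S.≐ S.var S.here) →
      eqo ≡ subst (λ n → S.Formula (ctx n ++ ctx n)) (sym k≡1) (S.var S.here S.≐ S.var (S.there S.here)) →
      ProvesAxiom (interpretation k (dim c) δo (dom c) member eqo (eqT c)) emptyClass →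
      ProvesAxiom (interpretation k (dim c) δo (dom c) member eqo (eqT c)) adjunction →
      Σ (DirectClasses L) (ProvesClassAxioms T)
    normalise _ _ _ member refl refl refl empty adjoin =
      record { dimᶜ = dim c ; isClass = dom c ; memberOf = member ; sameClass = eqT c } , empty , adjoin

module SchroederBernstein
  {L : OneSorted} (C : DirectClasses L) (T : Syntax.Theory (toSig L))
  (classAxioms : ProvesClassAxioms T C)
  {A B : Syntax.Formula (toSig L) (ctx 1)} {EA EB F G : Syntax.Formula (toSig L) (ctx 2)}
  (equivA : EquivRelOn L T A EA) (equivB : EquivRelOn L T B EB)
  (injF : Injection L T A EA B EB F) (injG : Injection L T B EB A EA G)
  where

  open Enriched C
  open Proofs T
  open EquivalenceRules equivA renaming (E-refl to EA-refl; E-sym to EA-sym; E-trans to EA-trans)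
  open EquivalenceRules equivB renaming (E-refl to EB-refl; E-sym to EB-sym)
  open InjectionRules injF renaming
    (R-dom to F-dom; R-cod to F-cod; R-resp to F-resp; R-total to F-total;
     R-functional to F-functional; R-injective to F-injective)
  open InjectionRules injG renaming
    (R-dom to G-dom; R-cod to G-cod; R-resp to G-resp; R-total to G-total;
     R-functional to G-functional; R-injective to G-injective)
  open AC using (_∋_; here; there)

  private
    emptyClass-ax : Syntax.Proves (toSig L) T ⟦ emptyClassᶠ ⟧
    emptyClass-ax = proj₁ classAxioms

    adjunction-ax : Syntax.Proves (toSig L) T ⟦ adjunctionᶠ ⟧
    adjunction-ax = proj₂ classAxioms

  there² : ∀ {Γ s a b} → Γ ∋ s → (a ∷ b ∷ Γ) ∋ s
  there² x = there (there x)

  there³ : ∀ {Γ s a b d} → Γ ∋ s → (a ∷ b ∷ d ∷ Γ) ∋ s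
  there³ x = there (there (there x))

  BacktracksInto : ∀ {Γ} → Γ ∋ c → Γ ∋ o → Fm Γ
  BacktracksInto X y = ∀ᶠ o (¬ᶠ (at₂ F here (there y))) ∨ᶠ ∃ᶠ o (here ∈ᶠ there X ∧ᶠ at₂ F here (there y))

  BackClosed : ∀ {Γ} → Γ ∋ c → Γ ∋ c → Fm Γ
  BackClosed XA XB = ∀ᶠ o (here ∈ᶠ there XA ⇒ᶠ ∃ᶠ o (here ∈ᶠ there² XB ∧ᶠ at₂ G here (there here)))
                  ∧ᶠ ∀ᶠ o (here ∈ᶠ there XB ⇒ᶠ BacktracksInto (there XA) here)

  Traced : ∀ {Γ} → Γ ∋ o → Fm Γ
  Traced x = ∃ᶠ c (class here ∧ᶠ ∃ᶠ c (class here ∧ᶠ BackClosed (there here) here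
                   ∧ᶠ ∃ᶠ o (here ∈ᶠ there² here ∧ᶠ at₂ EA here (there³ x))))

  Adjoined : ∀ {Γ} → Γ ∋ c → Γ ∋ c → Γ ∋ o → Fm Γ
  Adjoined X′ X y = class X′ ∧ᶠ ∀ᶠ o (here ≐ᶠ here ⇒ᶠ (here ∈ᶠ there X′ ⇔ᶠ here ∈ᶠ there X ∨ᶠ here ≐ᶠ there y))

  Traced-intro : ∀ {Γ Φ XA XB a x} → Γ ∣ Φ ⊢ class XA → Γ ∣ Φ ⊢ class XB → Γ ∣ Φ ⊢ BackClosed XA XB →
                 Γ ∣ Φ ⊢ a ∈ᶠ XA → Γ ∣ Φ ⊢ at₂ EA a x → Γ ∣ Φ ⊢ Traced x
  Traced-intro {XA = XA} {XB} {a} cA cB closed a∈XA a~x =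
    ∃I _ XA (∧I cA (∃I _ XB (∧I cB (∧I closed (∃I _ a (∧I a∈XA a~x))))))

  adjoin : ∀ {Γ Φ} X y χ → Γ ∣ Φ ⊢ class X → c ∷ Γ ∣ Adjoined here (there X) (there y) ∷ map wkᶠ Φ ⊢ wkᶠ χ →
           Γ ∣ Φ ⊢ χ
  adjoin X y χ cX = ∃E χ (⇒E (∀E (⇒E (∀E (closed adjunctionᶠ adjunction-ax) X) cX) y) (≐-refl y))

  adjoined-intro : ∀ {Γ Φ X′ X y z} → Γ ∣ Φ ⊢ Adjoined X′ X y → Γ ∣ Φ ⊢ z ∈ᶠ X ∨ᶠ z ≐ᶠ y → Γ ∣ Φ ⊢ z ∈ᶠ X′
  adjoined-intro {z = z} adj = ⇒E (∧E₂ (⇒E (∀E (∧E₂ adj) z) (≐-refl z)))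

  adjoined-elim : ∀ {Γ Φ X′ X y z} → Γ ∣ Φ ⊢ Adjoined X′ X y → Γ ∣ Φ ⊢ z ∈ᶠ X′ → Γ ∣ Φ ⊢ z ∈ᶠ X ∨ᶠ z ≐ᶠ y
  adjoined-elim {z = z} adj = ⇒E (∧E₁ (⇒E (∀E (∧E₂ adj) z) (≐-refl z)))

  BacktracksInto-adjoined : ∀ {Γ Φ X′ X x y} → Γ ∣ Φ ⊢ Adjoined X′ X x →
                            Γ ∣ Φ ⊢ BacktracksInto X y → Γ ∣ Φ ⊢ BacktracksInto X′ y
  BacktracksInto-adjoined adj back =
    ∨E back (∨I₁ _ h₀) (∃E _ h₀ (∨I₂ _ (∃I _ here (∧I (adjoined-intro (↑ (↑ʰ adj)) (∨I₁ _ (∧E₁ h₀))) (∧E₂ h₀)))))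

  BackClosed-empty : ∀ {Γ Φ X} → Γ ∣ Φ ⊢ ∀ᶠ o (here ≐ᶠ here ⇒ᶠ ¬ᶠ (here ∈ᶠ there X)) → Γ ∣ Φ ⊢ BackClosed X X
  BackClosed-empty {Γ} {Φ} {X} empty = ∧I (∀I (⇒I no-member)) (∀I (⇒I no-member))
    where
    no-member : ∀ {χ} → o ∷ Γ ∣ here ∈ᶠ there X ∷ map wkᶠ Φ ⊢ χ
    no-member = contradiction h₀ (⇒E (∀E (↑ empty) here) (≐-refl here))

  BackClosed-adjoined : ∀ {Γ Φ XA′ XA XB′ XB x y} →
    Γ ∣ Φ ⊢ Adjoined XA′ XA x → Γ ∣ Φ ⊢ Adjoined XB′ XB y → Γ ∣ Φ ⊢ BackClosed XA XB →
    Γ ∣ Φ ⊢ BacktracksInto XA y → Γ ∣ Φ ⊢ at₂ G y x → Γ ∣ Φ ⊢ BackClosed XA′ XB′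
  BackClosed-adjoined {Γ} {Φ} {XA′} {XA} {XB′} {y = y} adjA adjB closed back gyx =
    ∧I (∀I (⇒I preimages)) (∀I (⇒I backtracks))
    where
    preimages : o ∷ Γ ∣ here ∈ᶠ there XA′ ∷ map wkᶠ Φ ⊢ ∃ᶠ o (here ∈ᶠ there² XB′ ∧ᶠ at₂ G here (there here))
    preimages = ∨E (adjoined-elim (↑ adjA) h₀)
      (∃E _ (⇒E (∀E (∧E₁ (↑ʰ (↑ closed))) here) h₀)
            (∃I _ here (∧I (adjoined-intro (↑ (↑ʰ (↑ adjB))) (∨I₁ _ (∧E₁ h₀))) (∧E₂ h₀))))
      (∃I _ (there y) (∧I (adjoined-intro (↑ʰ (↑ adjB)) (∨I₂ _ (≐-refl _)))
                          (≐-subst (at₂ G (there² y) here) (≐-sym h₀) (↑ʰ (↑ gyx)))))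

    backtracks : o ∷ Γ ∣ here ∈ᶠ there XB′ ∷ map wkᶠ Φ ⊢ BacktracksInto (there XA′) here
    backtracks = ∨E (adjoined-elim (↑ adjB) h₀)
      (BacktracksInto-adjoined (↑ʰ (↑ adjA)) (⇒E (∀E (∧E₂ (↑ʰ (↑ closed))) here) h₀))
      (BacktracksInto-adjoined (↑ʰ (↑ adjA)) (≐-subst (BacktracksInto (there² XA) here) (≐-sym h₀) (↑ʰ (↑ back))))

  Traced-extend : ∀ {Γ Φ XA XB x y} → Γ ∣ Φ ⊢ class XA → Γ ∣ Φ ⊢ class XB → Γ ∣ Φ ⊢ BackClosed XA XB →
                  Γ ∣ Φ ⊢ BacktracksInto XA y → Γ ∣ Φ ⊢ at₂ G y x → Γ ∣ Φ ⊢ Traced x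
  Traced-extend {XA = XA} {XB} {x} {y} cA cB closed back gyx =
    adjoin XB y _ cB (adjoin (there XA) (there x) _ (↑ cA)
      (Traced-intro (∧E₁ h₀) (∧E₁ h₁) (BackClosed-adjoined h₀ h₁ (↑ (↑ closed)) (↑ (↑ back)) (↑ (↑ gyx)))
                    (adjoined-intro h₀ (∨I₂ _ (≐-refl _))) (EA-refl (G-cod (↑ (↑ gyx))))))

  Traced-unreached : ∀ {Γ Φ x y} → Γ ∣ Φ ⊢ ∀ᶠ o (¬ᶠ (at₂ F here (there y))) → Γ ∣ Φ ⊢ at₂ G y x → Γ ∣ Φ ⊢ Traced x
  Traced-unreached unreached gyx =
    ∃E _ (closed emptyClassᶠ emptyClass-ax)
      (Traced-extend (∧E₁ h₀) (∧E₁ h₀) (BackClosed-empty (∧E₂ h₀)) (∨I₁ _ (↑ unreached)) (↑ gyx))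

  Traced-forward : ∀ {Γ Φ z y x} → Γ ∣ Φ ⊢ Traced z → Γ ∣ Φ ⊢ at₂ F z y → Γ ∣ Φ ⊢ at₂ G y x → Γ ∣ Φ ⊢ Traced x
  Traced-forward traced fzy gyx = ∃E _ traced (∃E _ (∧E₂ h₀) (∃E _ (∧E₂ (∧E₂ h₀))
    (Traced-extend (∧E₁ h₂) (∧E₁ h₁) (∧E₁ (∧E₂ h₁))
      (∨I₂ _ (∃I _ here (∧I (∧E₁ h₀) (F-resp (∧E₂ h₀) (↑ (↑ (↑ fzy))) (EB-refl (F-cod (↑ (↑ (↑ fzy)))))))))
      (↑ (↑ (↑ gyx))))))

  Traced-resp : ∀ {Γ Φ x x′} → Γ ∣ Φ ⊢ at₂ EA x x′ → Γ ∣ Φ ⊢ Traced x′ → Γ ∣ Φ ⊢ Traced x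
  Traced-resp x~x′ traced = ∃E _ traced (∃E _ (∧E₂ h₀) (∃E _ (∧E₂ (∧E₂ h₀))
    (Traced-intro (∧E₁ h₂) (∧E₁ h₁) (∧E₁ (∧E₂ h₁)) (∧E₁ h₀) (EA-trans (∧E₂ h₀) (EA-sym (↑ (↑ (↑ x~x′))))))))

  Traced⇒G-image : ∀ {Γ Φ x} → Γ ∣ Φ ⊢ Traced x → Γ ∣ Φ ⊢ ∃ᶠ o (at₂ G here (there x))
  Traced⇒G-image traced = ∃E _ traced (∃E _ (∧E₂ h₀) (∃E _ (∧E₂ (∧E₂ h₀))
    (∃E _ (⇒E (∀E (∧E₁ (∧E₁ (∧E₂ h₁))) here) (∧E₁ h₀))
      (∃I _ here (G-resp (EB-refl (G-dom (∧E₂ h₀))) (∧E₂ h₀) (∧E₂ h₁))))))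

  -- The G-preimage b of a in XB is EB-equal to y, so x′ is an F-preimage of b and hence
  -- EA-equal to the F-preimage of b that back-closedness puts in XA.
  BackClosed-back : ∀ {Γ Φ XA XB a x y x′} → Γ ∣ Φ ⊢ BackClosed XA XB → Γ ∣ Φ ⊢ a ∈ᶠ XA → Γ ∣ Φ ⊢ at₂ EA a x →
    Γ ∣ Φ ⊢ at₂ G y x → Γ ∣ Φ ⊢ at₂ F x′ y → Γ ∣ Φ ⊢ ∃ᶠ o (here ∈ᶠ there XA ∧ᶠ at₂ EA here (there x′))
  BackClosed-back {Γ} {Φ} {XB = XB} {a} {x′ = x′} closed a∈XA a~x gyx fx′y =
    ∃E _ (⇒E (∀E (∧E₁ closed) a) a∈XA)
      (∨E (⇒E (∀E (∧E₂ (↑ closed)) here) (∧E₁ h₀))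
          (contradiction (↑ʰ fx′b) (∀E h₀ (there x′)))
          (∃E _ h₀ (∃I _ here (∧I (∧E₁ h₀) (F-injective (∧E₂ h₀) (↑ (↑ʰ fx′b)))))))
    where
    fx′b : o ∷ Γ ∣ here ∈ᶠ there XB ∧ᶠ at₂ G here (there a) ∷ map wkᶠ Φ ⊢ at₂ F (there x′) here
    fx′b = F-resp (EA-refl (F-dom (↑ fx′y))) (↑ fx′y)
                  (G-injective (↑ gyx) (G-resp (EB-refl (G-dom (∧E₂ h₀))) (∧E₂ h₀) (↑ a~x)))

  Traced-back : ∀ {Γ Φ x y x′} → Γ ∣ Φ ⊢ Traced x → Γ ∣ Φ ⊢ at₂ G y x → Γ ∣ Φ ⊢ at₂ F x′ y → Γ ∣ Φ ⊢ Traced x′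
  Traced-back traced gyx fx′y = ∃E _ traced (∃E _ (∧E₂ h₀) (∃E _ (∧E₂ (∧E₂ h₀))
    (∃E _ (BackClosed-back (∧E₁ (∧E₂ h₁)) (∧E₁ h₀) (∧E₂ h₀) (↑ (↑ (↑ gyx))) (↑ (↑ (↑ fx′y))))
      (Traced-intro (∧E₁ h₃) (∧E₁ h₂) (∧E₁ (∧E₂ h₂)) (∧E₁ h₀) (∧E₂ h₀)))))

  Hᶠ : Fm (o ∷ o ∷ [])
  Hᶠ = (Traced here ∧ᶠ at₂ G (there here) here) ∨ᶠ (¬ᶠ (Traced here) ∧ᶠ at₂ F here (there here))

  H : Syntax.Formula (toSig L) (ctx 2)
  H = ⟦ Hᶠ ⟧

  H-cases : ∀ {Γ Φ x y} → Γ ∣ Φ ⊢ at₂ H x y →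
            Γ ∣ Φ ⊢ (Traced x ∧ᶠ at₂ G y x) ∨ᶠ (¬ᶠ (Traced x) ∧ᶠ at₂ F x y)
  H-cases {x = x} {y} = unfold Hᶠ x y

  H-via-G : ∀ {Γ Φ x y} → Γ ∣ Φ ⊢ Traced x → Γ ∣ Φ ⊢ at₂ G y x → Γ ∣ Φ ⊢ at₂ H x y
  H-via-G {x = x} {y} traced gyx = fold Hᶠ x y (∨I₁ _ (∧I traced gyx))

  H-via-F : ∀ {Γ Φ x y} → Γ ∣ Φ ⊢ ¬ᶠ (Traced x) → Γ ∣ Φ ⊢ at₂ F x y → Γ ∣ Φ ⊢ at₂ H x y
  H-via-F {x = x} {y} untraced fxy = fold Hᶠ x y (∨I₂ _ (∧I untraced fxy))

  H-dom-cod : ∀ {Γ Φ x y} → Γ ∣ Φ ⊢ at₂ H x y → Γ ∣ Φ ⊢ at₁ A x ∧ᶠ at₁ B y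
  H-dom-cod hxy = ∨E (H-cases hxy)
    (∧I (G-cod (∧E₂ h₀)) (G-dom (∧E₂ h₀)))
    (∧I (F-dom (∧E₂ h₀)) (F-cod (∧E₂ h₀)))

  H-resp : ∀ {Γ Φ x x′ y′ y} → Γ ∣ Φ ⊢ at₂ EA x x′ → Γ ∣ Φ ⊢ at₂ H x′ y′ → Γ ∣ Φ ⊢ at₂ EB y′ y →
           Γ ∣ Φ ⊢ at₂ H x y
  H-resp x~x′ hx′y′ y′~y = ∨E (H-cases hx′y′)
    (H-via-G (Traced-resp (↑ʰ x~x′) (∧E₁ h₀)) (G-resp (EB-sym (↑ʰ y′~y)) (∧E₂ h₀) (EA-sym (↑ʰ x~x′))))
    (H-via-F (⇒I (contradiction (Traced-resp (EA-sym (↑ʰ (↑ʰ x~x′))) h₀) (∧E₁ h₁)))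
             (F-resp (↑ʰ x~x′) (∧E₂ h₀) (↑ʰ y′~y)))

  H-total : ∀ {Γ Φ x} → Γ ∣ Φ ⊢ at₁ A x → Γ ∣ Φ ⊢ ∃ᶠ o (at₂ H (there x) here)
  H-total {x = x} ax = by-cases (Traced x)
    (∃E _ (Traced⇒G-image h₀) (∃I _ here (H-via-G h₁ h₀)))
    (∃E _ (F-total (↑ʰ ax)) (∃I _ here (H-via-F h₁ h₀)))

  H-functional : ∀ {Γ Φ x y y′} → Γ ∣ Φ ⊢ at₂ H x y → Γ ∣ Φ ⊢ at₂ H x y′ → Γ ∣ Φ ⊢ at₂ EB y y′
  H-functional hxy hxy′ = ∨E (H-cases hxy)
    (∨E (H-cases (↑ʰ hxy′)) (G-injective (∧E₂ h₁) (∧E₂ h₀)) (contradiction (∧E₁ h₁) (∧E₁ h₀)))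
    (∨E (H-cases (↑ʰ hxy′)) (contradiction (∧E₁ h₀) (∧E₁ h₁)) (F-functional (∧E₂ h₁) (∧E₂ h₀)))

  H-injective : ∀ {Γ Φ x x′ y} → Γ ∣ Φ ⊢ at₂ H x y → Γ ∣ Φ ⊢ at₂ H x′ y → Γ ∣ Φ ⊢ at₂ EA x x′
  H-injective hxy hx′y = ∨E (H-cases hxy)
    (∨E (H-cases (↑ʰ hx′y))
        (G-functional (∧E₂ h₁) (∧E₂ h₀))
        (contradiction (Traced-back (∧E₁ h₁) (∧E₂ h₁) (∧E₂ h₀)) (∧E₁ h₀)))
    (∨E (H-cases (↑ʰ hx′y))
        (contradiction (Traced-back (∧E₁ h₀) (∧E₂ h₀) (∧E₂ h₁)) (∧E₁ h₁))
        (F-injective (∧E₂ h₁) (∧E₂ h₀)))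

  -- If x = G y is untraced, y is an F-image (Traced-unreached) of some x′, and x′ is untraced
  -- (Traced-forward), so H x′ y.
  H-surjective : ∀ {Γ Φ y} → Γ ∣ Φ ⊢ at₁ B y → Γ ∣ Φ ⊢ ∃ᶠ o (at₂ H here (there y))
  H-surjective {y = y} by = ∃E _ (G-total by) (by-cases (Traced here)
    (∃I _ here (H-via-G h₀ h₁))
    (by-cases (∃ᶠ o (at₂ F here (there² y)))
      (∃E _ h₀ (by-cases (Traced here)
        (contradiction (Traced-forward h₀ h₁ h₄) h₃)
        (∃I _ here (H-via-F h₀ h₁))))
      (contradiction (Traced-unreached (∀I (⇒I (⇒E h₁ (∃I _ here h₀)))) h₂) h₁)))

  H-bijection : Bijection L T A EA B EB H
  H-bijection =
    ( proves (∀I (∀I (⇒I (H-dom-cod {x = v₁} {v₀} h₀))))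
    , proves (∀I (∀I (∀I (∀I (⇒I (H-resp {x = v₃} {v₂} {v₁} {v₀} (∧E₁ h₀) (∧E₁ (∧E₂ h₀)) (∧E₂ (∧E₂ h₀))))))))
    , proves (∀I (⇒I (H-total {x = v₀} h₀)))
    , proves (∀I (∀I (∀I (⇒I (H-functional {x = v₂} {v₁} {v₀} (∧E₁ h₀) (∧E₂ h₀))))))
    , proves (∀I (∀I (∀I (⇒I (H-injective {x = v₂} {v₁} {v₀} (∧E₁ h₀) (∧E₂ h₀)))))) )
    , proves (∀I (⇒I (H-surjective {y = v₀} h₀)))
    where
    v₀ : ∀ {Γ} → o ∷ Γ ∋ o
    v₀ = here
    v₁ : ∀ {Γ a} → a ∷ o ∷ Γ ∋ o
    v₁ = there here
    v₂ : ∀ {Γ a b} → a ∷ b ∷ o ∷ Γ ∋ o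
    v₂ = there² here
    v₃ : ∀ {Γ a b d} → a ∷ b ∷ d ∷ o ∷ Γ ∋ o
    v₃ = there³ here

corollary4p6 : (L : OneSorted) (T : Syntax.Theory (toSig L)) → Conceptual L T
    → (A B : Syntax.Formula (toSig L) (ctx 1))
    → (EA EB F G : Syntax.Formula (toSig L) (ctx 2))
    → EquivRelOn L T A EA
    → EquivRelOn L T B EB
    → Injection L T A EA B EB F
    → Injection L T B EB A EA G
    → Σ (Syntax.Formula (toSig L) (ctx 2)) (λ H → Bijection L T A EA B EB H)
corollary4p6 L T conceptual A B EA EB F G equivA equivB injF injG =
  let C , classAxioms = conceptual⇒directClasses conceptual
      open SchroederBernstein C T classAxioms equivA equivB injF injG
  in H , H-bijection
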